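{- Let $p\equiv 3\pmod 4$ be a prime and let $n$ and $a$ be positive integers such that (i) the diagonal ternary quadratic form $x^2+y^2+az^2$ has class number $1$; (ii) $a$ is either a square or a sum of $2$ squares not divisible by $p$; (iii) $\left(\frac{a}{p}\right)=1$ and $n$ is divisible by $p$; (iv) $n$ is represented by $x^2+y^2+az^2$ over the integers. Then $n$ is a sum of $3$ squares not divisible by $p$ if $a$ is a square, and $n$ is a sum of $4$ squares not divisible by $p$ if $a$ is a sum of $2$ squares not divisible by $p$.
   Context: For a prime $p$, an integer $n$ is a sum of $k$ squares not divisible by $p$ if there are integers $x_1,\dots,x_k$ with $n=x_1^2+\cdots+x_k^2$ and $\gcd(p,x_1x_2\cdots x_k)=1$. The class number of a positive definite integral quadratic form is the number of integral isometry classes in its genus (the set of forms isometric to it over $\mathbb{Z}_q$ for every prime $q$). $\left(\frac{\cdot}{p}\right)$ is the Legendre symbol. -}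

module Defs where

open import Data.Nat as ℕ using (ℕ; suc; zero)
open import Data.Nat.Primality using (Prime)
open import Data.Nat.Coprimality using (Coprime)
open import Data.Integer using (ℤ; +_; _+_; _*_; _-_; -_; ∣_∣; _<_; 0ℤ; 1ℤ)
open import Data.Integer.Divisibility using (_∣_)
open import Data.Fin using (Fin; zero; suc)
open import Data.Product using (Σ; ∃; _×_; _,_)
open import Data.Sum using (_⊎_)
open import Relation.Binary.PropositionalEquality using (_≡_; _≢_)
open import Relation.Nullary using (¬_)

sumℤ : ∀ {k} → (Fin k → ℤ) → ℤ
sumℤ {zero}  f = 0ℤ
sumℤ {suc k} f = f zero + sumℤ (λ i → f (suc i))

prodℤ : ∀ {k} → (Fin k → ℤ) → ℤ
prodℤ {zero}  f = 1ℤ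
prodℤ {suc k} f = f zero * prodℤ (λ i → f (suc i))

SumOfSquaresNotDiv : ℕ → ℕ → ℕ → Set
SumOfSquaresNotDiv k p n =
  Σ (Fin k → ℤ) λ x → (+ n ≡ sumℤ (λ i → x i * x i)) × Coprime p ∣ prodℤ x ∣

IsSquare : ℕ → Set
IsSquare a = Σ ℕ λ m → a ≡ m ℕ.* m

LegendreIsOne : ℕ → ℕ → Set
LegendreIsOne a p = ¬ ((+ p) ∣ (+ a)) × Σ ℤ λ x → (+ p) ∣ (x * x - + a)

-- Ternary integral quadratic forms, given by symmetric integral Gram
-- matrices A; the form is Q_A(x) = xᵀ A x.

Mat3 : Set
Mat3 = Fin 3 → Fin 3 → ℤ

Vec3 : Set
Vec3 = Fin 3 → ℤ

Symmetric : Mat3 → Set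
Symmetric A = ∀ i j → A i j ≡ A j i

evalQF : Mat3 → Vec3 → ℤ
evalQF A x = sumℤ (λ i → sumℤ (λ j → x i * A i j * x j))

PositiveDefinite : Mat3 → Set
PositiveDefinite A = ∀ (x : Vec3) → (Σ (Fin 3) λ i → x i ≢ 0ℤ) → 0ℤ < evalQF A x

congruent : Mat3 → Mat3 → Mat3
congruent M A i j = sumℤ (λ k → sumℤ (λ l → M k i * A k l * M l j))

det3 : Mat3 → ℤ
det3 M =
    M zero zero * (M (suc zero) (suc zero) * M (suc (suc zero)) (suc (suc zero))
                   - M (suc zero) (suc (suc zero)) * M (suc (suc zero)) (suc zero))
  - M zero (suc zero) * (M (suc zero) zero * M (suc (suc zero)) (suc (suc zero))
                   - M (suc zero) (suc (suc zero)) * M (suc (suc zero)) zero)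
  + M zero (suc (suc zero)) * (M (suc zero) zero * M (suc (suc zero)) (suc zero)
                   - M (suc zero) (suc zero) * M (suc (suc zero)) zero)

Isometricℤ : Mat3 → Mat3 → Set
Isometricℤ A B = Σ Mat3 λ M → (∣ det3 M ∣ ≡ 1) × (∀ i j → congruent M A i j ≡ B i j)

-- Isometry over ℤ_q, written out via the inverse limit ℤ_q = lim ℤ/q^kℤ:
-- for every k there is an integral M with det M a q-adic unit and
-- Mᵀ A M ≡ B (mod q^k) entrywise.  (By compactness of GL₃(ℤ_q) this is
-- equivalent to existence of M ∈ GL₃(ℤ_q) with Mᵀ A M = B.)
IsometricℤAt : ℕ → Mat3 → Mat3 → Set
IsometricℤAt q A B = ∀ (k : ℕ) → Σ Mat3 λ M →
  ¬ ((+ q) ∣ det3 M) × (∀ i j → (+ (q ℕ.^ k)) ∣ (congruent M A i j - B i j))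

SameGenus : Mat3 → Mat3 → Set
SameGenus A B = ∀ (q : ℕ) → Prime q → IsometricℤAt q A B

ClassNumberOne : Mat3 → Set
ClassNumberOne A = ∀ (B : Mat3) → Symmetric B → PositiveDefinite B → SameGenus A B → Isometricℤ A B

diag11a : ℕ → Mat3
diag11a a zero zero = 1ℤ
diag11a a (suc zero) (suc zero) = 1ℤ
diag11a a (suc (suc zero)) (suc (suc zero)) = + a
diag11a a _ _ = 0ℤ

RepresentedBy11a : ℕ → ℕ → Set
RepresentedBy11a a n = Σ ℤ λ x → Σ ℤ λ y → Σ ℤ λ z → + n ≡ x * x + y * y + + a * (z * z)

{-# OPTIONS --safe #-}
-- Let Q = x² + y² + a z², with Gram matrix D and polar form β.  Since −1 is a non-residue
-- modulo p and a ≡ s², Q ≡ x² + y² + (s z)² has no zero modulo p in which p divides some but not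
-- all coordinates; so a representation of n that is primitive at p has all coordinates prime to p.
-- Primitive representations come from descent: if p divides every coordinate of a representation
-- of N, divide it out to represent N / p², and lift back as follows.  Choose u = (u₁, u₂, 1) with
-- Q(u) ≡ 0 (mod p²) and p ∤ u₁ u₂ (pigeonhole and Hensel), and let T₁ have columns u, p (r, 1, 0)
-- and p² e₀, where u₁ r + u₂ ≡ 0 (mod p).  Then B = T₁ᵀ D T₁ / p² is integral, positive definite
-- and in the genus of D, so class number one gives M ∈ GL₃(ℤ) with Mᵀ D M = B.  For primitive w
-- with Q(w) = N, ξ = T₁⁻¹ (p² w) is integral and M ξ represents p² N; it is primitive as soon as
-- p ∤ β(u, w), which changing the signs of w arranges.
module Submission where

open import Defs
open import Data.Nat using (ℕ; _%_; _<_)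
open import Data.Nat.Primality using (Prime)
open import Data.Product using (_×_)
open import Data.Sum using (_⊎_)
open import Relation.Binary.PropositionalEquality using (_≡_)
open import Data.Nat.Divisibility using (_∣_)

open import Data.Nat as ℕ using (zero; suc; _!)
import Data.Nat.Properties as ℕ
open import Data.Nat.Properties using (_!*_!≢0)
import Data.Nat.Divisibility as ℕ
open import Data.Nat.Divisibility using (_∣0; m∣m*n; ∣1⇒≡1; >⇒∤)
open import Data.Nat.DivMod using (m*[n/m]≡n; m≡m%n+[m/n]*n)
open import Data.Nat.Primality using (euclidsLemma; prime⇒nonZero; prime⇒nonTrivial; prime⇒irreducible; ¬prime[1])
open import Data.Nat.Combinatorics using (_C_; nCn≡1; k![n∸k]!∣n!; nCk≡n!/k![n-k]!)
open import Data.Nat.Coprimality using (Coprime)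
open import Data.Nat.Induction using (<-rec)
import Data.Nat.Tactic.RingSolver as ℕ-Solver
open import Data.Fin as Fin using (Fin; zero; suc; toℕ; fromℕ; fromℕ<; inject₁; splitAt)
import Data.Fin.Properties as Fin
open import Data.Fin.Patterns using (0F; 1F; 2F; 3F)
open import Data.Vec.Functional using (_∷_; [])
open import Data.Integer as ℤ using (ℤ; +_; -[1+_]; _+_; _*_; _-_; -_; ∣_∣; 0ℤ; 1ℤ; _^_)
import Data.Integer.Properties as ℤ
import Data.Integer.Divisibility.Signed as ℤ
open import Data.Integer.Divisibility.Signed using (divides)
import Data.Integer.DivMod as ℤ
open import Data.Integer.Tactic.RingSolver using (solve-∀)
open import Data.Product using (∃; ∃₂; Σ; _,_; proj₁; proj₂)
open import Data.Sum as Sum using (inj₁; inj₂)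
open import Function using (_∘_; id)
open import Relation.Binary using (tri<; tri≈; tri>)
open import Relation.Nullary using (¬_; contradiction; yes; no)
open import Relation.Binary.PropositionalEquality
  using (_≢_; refl; sym; trans; cong; cong₂; subst; subst₂; module ≡-Reasoning)
import Algebra.Properties.CommutativeSemiring.Binomial ℤ.+-*-commutativeSemiring as Binomial
import Algebra.Properties.CommutativeSemiring.Exp ℤ.+-*-commutativeSemiring as Exp
import Algebra.Properties.Monoid.Sum ℤ.+-0-monoid as ∑
import Algebra.Properties.Monoid.Mult ℤ.+-0-monoid as Mult

-- Arithmetic modulo a prime

euclidsLemmaℤ : ∀ x y {p} → Prime p → + p ℤ.∣ x * y → + p ℤ.∣ x ⊎ + p ℤ.∣ y
euclidsLemmaℤ x y {p} p-prime p∣xy =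
  Sum.map ℤ.∣ᵤ⇒∣ ℤ.∣ᵤ⇒∣
    (euclidsLemma ∣ x ∣ ∣ y ∣ p-prime (subst (p ∣_) (ℤ.abs-* x y) (ℤ.∣⇒∣ᵤ p∣xy)))

∤*∤⇒∤* : ∀ {p x y} → Prime p → ¬ + p ℤ.∣ x → ¬ + p ℤ.∣ y → ¬ + p ℤ.∣ x * y
∤*∤⇒∤* {x = x} {y} p-prime p∤x p∤y p∣xy = Sum.[ p∤x , p∤y ] (euclidsLemmaℤ x y p-prime p∣xy)

prime∤1 : ∀ {p} → Prime p → ¬ + p ℤ.∣ 1ℤ
prime∤1 p-prime p∣1 = ℕ.nonTrivial⇒≢1 {{prime⇒nonTrivial p-prime}} (∣1⇒≡1 (ℤ.∣⇒∣ᵤ p∣1))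

n∣n! : ∀ n → .{{ℕ.NonZero n}} → n ∣ n !
n∣n! (suc n) = m∣m*n (n !)

prime∤! : ∀ {p m} → Prime p → m < p → ¬ p ∣ m !
prime∤! {p} {zero} p-prime _ p∣1 = ℕ.nonTrivial⇒≢1 {{prime⇒nonTrivial p-prime}} (∣1⇒≡1 p∣1)
prime∤! {p} {suc m} p-prime m<p p∣m! with euclidsLemma (suc m) (m !) p-prime p∣m!
... | inj₁ p∣1+m = >⇒∤ m<p p∣1+m
... | inj₂ p∣m! = prime∤! p-prime (ℕ.<-trans (ℕ.n<1+n m) m<p) p∣m!

p∣pCk : ∀ {p k} → Prime p → 0 < k → k < p → p ∣ p C k
p∣pCk {p} {k} p-prime 0<k k<p with euclidsLemma (k ! ℕ.* (p ℕ.∸ k) !) (p C k) p-prime p∣factorials*C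
  where
  instance _ = k !* (p ℕ.∸ k) !≢0
  k≤p : k ℕ.≤ p
  k≤p = ℕ.<⇒≤ k<p
  p∣factorials*C : p ∣ k ! ℕ.* (p ℕ.∸ k) ! ℕ.* (p C k)
  p∣factorials*C = subst (p ∣_)
    (sym (trans (cong (k ! ℕ.* (p ℕ.∸ k) ! ℕ.*_) (nCk≡n!/k![n-k]! k≤p)) (m*[n/m]≡n (k![n∸k]!∣n! k≤p))))
    (n∣n! p {{prime⇒nonZero p-prime}})
... | inj₂ p∣C = p∣C
... | inj₁ p∣factorials with euclidsLemma (k !) ((p ℕ.∸ k) !) p-prime p∣factorials
...   | inj₁ p∣k! = contradiction p∣k! (prime∤! p-prime k<p)
...   | inj₂ p∣[p-k]! = contradiction p∣[p-k]! (prime∤! p-prime (ℕ.∸-monoʳ-< 0<k (ℕ.<⇒≤ k<p)))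

×≡* : ∀ n x → n Mult.× x ≡ + n * x
×≡* zero x = sym (ℤ.*-zeroˡ x)
×≡* (suc n) x = begin
  x + n Mult.× x   ≡⟨ cong (λ z → x + z) (×≡* n x) ⟩
  x + + n * x      ≡⟨ cong (_+ + n * x) (sym (ℤ.*-identityˡ x)) ⟩
  1ℤ * x + + n * x ≡⟨ sym (ℤ.*-distribʳ-+ x 1ℤ (+ n)) ⟩
  + suc n * x      ∎
  where open ≡-Reasoning

^′≡^ : ∀ x n → x Exp.^ n ≡ x ^ n
^′≡^ x zero = refl
^′≡^ x (suc n) = cong (x *_) (^′≡^ x n)

∣-sum : ∀ {d n} (f : Fin n → ℤ) → (∀ i → d ℤ.∣ f i) → d ℤ.∣ ∑.sum f
∣-sum {n = zero} f d∣f = ℤ.∣ᵤ⇒∣ (_ ∣0)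
∣-sum {n = suc n} f d∣f = ℤ.∣m∣n⇒∣m+n (d∣f Fin.zero) (∣-sum (f ∘ Fin.suc) (d∣f ∘ Fin.suc))

frobenius : ∀ {p} → Prime p → ∀ x y → + p ℤ.∣ (x + y) ^ p - x ^ p - y ^ p
frobenius {suc m} p-prime x y = subst (+ suc m ℤ.∣_) (sym expansion) (∣-sum middle p∣middle)
  where
  p : ℕ
  p = suc m
  term : Fin (suc p) → ℤ
  term = Binomial.binomialTerm x y p
  middle : Fin m → ℤ
  middle k = term (Fin.suc (inject₁ k))

  p∣middle : ∀ k → + p ℤ.∣ middle k
  p∣middle k = subst (+ p ℤ.∣_) (sym (×≡* (p C suc j) _))
    (ℤ.∣m⇒∣m*n (Binomial.binomial x y p (Fin.suc (inject₁ k)))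
      (ℤ.∣ᵤ⇒∣ {k = + p} {i = + (p C suc j)} (p∣pCk p-prime ℕ.z<s (ℕ.s<s j<m))))
    where
    j : ℕ
    j = toℕ (inject₁ k)
    j<m : j < m
    j<m = subst (_< m) (sym (Fin.toℕ-inject₁ k)) (Fin.toℕ<n k)

  first : term Fin.zero ≡ y ^ p
  first = trans (ℤ.+-identityʳ _) (trans (ℤ.*-identityˡ _) (^′≡^ y p))

  termAt : ℕ → ℤ
  termAt j = (p C j) Mult.× (x Exp.^ j * y Exp.^ (p ℕ.∸ j))

  last : term (fromℕ p) ≡ x ^ p
  last = begin
    termAt (toℕ (fromℕ p))
      ≡⟨ cong termAt (Fin.toℕ-fromℕ p) ⟩
    termAt p
      ≡⟨ cong₂ (λ c e → c Mult.× (x Exp.^ p * y Exp.^ e)) (nCn≡1 p) (ℕ.n∸n≡0 p) ⟩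
    x Exp.^ p * 1ℤ + 0ℤ
      ≡⟨ trans (ℤ.+-identityʳ _) (trans (ℤ.*-identityʳ _) (^′≡^ x p)) ⟩
    x ^ p ∎
    where open ≡-Reasoning

  rearrange : ∀ a b c → a + (b + c) - c - a ≡ b
  rearrange = solve-∀

  open ≡-Reasoning
  expansion : (x + y) ^ p - x ^ p - y ^ p ≡ ∑.sum middle
  expansion = begin
    (x + y) ^ p - x ^ p - y ^ p
      ≡⟨ cong (λ z → z - x ^ p - y ^ p) (trans (sym (^′≡^ (x + y) p)) (Binomial.theorem p x y)) ⟩
    term Fin.zero + ∑.sum (term ∘ Fin.suc) - x ^ p - y ^ p
      ≡⟨ cong (λ z → term Fin.zero + z - x ^ p - y ^ p) (∑.sum-init-last (term ∘ Fin.suc)) ⟩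
    term Fin.zero + (∑.sum middle + term (fromℕ p)) - x ^ p - y ^ p
      ≡⟨ cong₂ (λ u v → u + (∑.sum middle + v) - x ^ p - y ^ p) first last ⟩
    y ^ p + (∑.sum middle + x ^ p) - x ^ p - y ^ p
      ≡⟨ rearrange (y ^ p) (∑.sum middle) (x ^ p) ⟩
    ∑.sum middle ∎

fermat : ∀ {p} → Prime p → ∀ x → + p ℤ.∣ x ^ p - x
fermat {suc m} p-prime = go
  where
  p : ℕ
  p = suc m
  p∣1^p-1 : + p ℤ.∣ 1ℤ ^ p - 1ℤ
  p∣1^p-1 = subst (λ z → + p ℤ.∣ z - 1ℤ) (sym (ℤ.^-zeroˡ p)) (ℤ.∣ᵤ⇒∣ (_ ∣0))

  split : ∀ A B C x → A - (1ℤ + x) ≡ (A - C - B) + (B - x) + (C - 1ℤ)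
  split = solve-∀

  up : ∀ x → + p ℤ.∣ x ^ p - x → + p ℤ.∣ (1ℤ + x) ^ p - (1ℤ + x)
  up x p∣x^p-x = subst (+ p ℤ.∣_) (sym (split ((1ℤ + x) ^ p) (x ^ p) (1ℤ ^ p) x))
    (ℤ.∣m∣n⇒∣m+n (ℤ.∣m∣n⇒∣m+n (frobenius p-prime 1ℤ x) p∣x^p-x) p∣1^p-1)

  down : ∀ x → + p ℤ.∣ (1ℤ + x) ^ p - (1ℤ + x) → + p ℤ.∣ x ^ p - x
  down x p∣ = ℤ.∣m+n∣m⇒∣n
    (ℤ.∣m+n∣n⇒∣m (subst (+ p ℤ.∣_) (split ((1ℤ + x) ^ p) (x ^ p) (1ℤ ^ p) x) p∣) p∣1^p-1)
    (frobenius p-prime 1ℤ x)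

  go : ∀ x → + p ℤ.∣ x ^ p - x
  go (+ zero) = ℤ.∣ᵤ⇒∣ (_ ∣0)
  go (+ suc n) = up (+ n) (go (+ n))
  go -[1+ zero ] = down -[1+ zero ] (go (+ zero))
  go -[1+ suc n ] = down -[1+ suc n ] (go -[1+ n ])

mod-inverse : ∀ {p} → Prime p → ∀ x → ¬ + p ℤ.∣ x → ∃ λ y → + p ℤ.∣ x * y - 1ℤ
mod-inverse {suc (suc m)} p-prime x p∤x = x ^ m ,
  Sum.[ (λ p∣x → contradiction p∣x p∤x) , id ] (euclidsLemmaℤ x (x * x ^ m - 1ℤ) p-prime
    (subst (_ ℤ.∣_) (factor x (x ^ m)) (fermat p-prime x)))
  where
  factor : ∀ x w → x * (x * w) - x ≡ x * (x * w - 1ℤ)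
  factor = solve-∀

∣a-b⇒∣aⁿ-bⁿ : ∀ {d a b} → d ℤ.∣ a - b → ∀ n → d ℤ.∣ a ^ n - b ^ n
∣a-b⇒∣aⁿ-bⁿ {d} d∣a-b zero = subst (d ℤ.∣_) (sym (ℤ.+-inverseʳ 1ℤ)) (ℤ.∣ᵤ⇒∣ (_ ∣0))
∣a-b⇒∣aⁿ-bⁿ {d} {a} {b} d∣a-b (suc n) = subst (_ ℤ.∣_) (sym (telescope a b (a ^ n) (b ^ n)))
  (ℤ.∣m∣n⇒∣m+n (ℤ.∣n⇒∣m*n a (∣a-b⇒∣aⁿ-bⁿ d∣a-b n)) (ℤ.∣m⇒∣m*n (b ^ n) d∣a-b))
  where
  telescope : ∀ a b A B → a * A - b * B ≡ a * (A - B) + (a - b) * B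
  telescope = solve-∀

∤-distinct-prime : ∀ {p q} → Prime p → Prime q → q ≢ p → ¬ + q ℤ.∣ + p
∤-distinct-prime p-prime q-prime q≢p q∣p with prime⇒irreducible p-prime (ℤ.∣⇒∣ᵤ q∣p)
... | inj₁ refl = ¬prime[1] q-prime
... | inj₂ q≡p = q≢p q≡p

∣*∣⇒∣* : ∀ {a b s t} → a ℤ.∣ s → b ℤ.∣ t → a * b ℤ.∣ s * t
∣*∣⇒∣* {a} {b} (divides c refl) (divides e refl) = divides (c * e) (regroup c a e b)
  where
  regroup : ∀ c a e b → c * a * (e * b) ≡ c * e * (a * b)
  regroup = solve-∀

mod-inverse-power : ∀ {q} d ι → + q ℤ.∣ 1ℤ - d * ι → ∀ K → ∃ λ y → + (q ℕ.^ suc K) ℤ.∣ 1ℤ - d * y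
mod-inverse-power {q} d ι q∣1-dι zero = ι , subst (λ m → + m ℤ.∣ 1ℤ - d * ι) (sym (ℕ.*-identityʳ q)) q∣1-dι
mod-inverse-power {q} d ι q∣1-dι (suc K) with mod-inverse-power d ι q∣1-dι K
... | y , qᴷ∣1-dy = y + ι * (1ℤ - d * y) ,
  subst₂ ℤ._∣_ (sym (ℤ.pos-* q (q ℕ.^ suc K))) (lift d ι y) (∣*∣⇒∣* q∣1-dι qᴷ∣1-dy)
  where
  lift : ∀ d ι y → (1ℤ - d * ι) * (1ℤ - d * y) ≡ 1ℤ - d * (y + ι * (1ℤ - d * y))
  lift = solve-∀

-- Newton's step x′ = x − g ι p, where x² + c = g p and 2 x ι ≡ 1 (mod p).
hensel : ∀ {p} → Prime p → ∀ x c → + p ℤ.∣ x * x + c → ¬ + p ℤ.∣ + 2 * x →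
         ∃ λ x′ → + p ℤ.∣ x′ - x × + p * + p ℤ.∣ x′ * x′ + c
hensel {p} p-prime x c (divides g x²+c≡gp) p∤2x with mod-inverse p-prime (+ 2 * x) p∤2x
... | ι , divides e 2xι-1≡ep = x + P * j , divides j (shift x P j) , divides (j * j - g * e) (begin
    (x + P * j) * (x + P * j) + c
      ≡⟨ expand x c P g ι ⟩
    (x * x + c) + (P * P * (j * j) - g * P * (+ 2 * x * ι - 1ℤ)) - g * P
      ≡⟨ cong₂ (λ u v → u + (P * P * (j * j) - g * P * v) - g * P) x²+c≡gp 2xι-1≡ep ⟩
    g * P + (P * P * (j * j) - g * P * (e * P)) - g * P
      ≡⟨ collect g P j e ⟩
    (j * j - g * e) * (P * P) ∎)
  where
  open ≡-Reasoning
  P j : ℤ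
  P = + p
  j = - (g * ι)
  shift : ∀ x P j → x + P * j - x ≡ j * P
  shift = solve-∀
  expand : ∀ x c P g ι → (x + P * - (g * ι)) * (x + P * - (g * ι)) + c
                       ≡ (x * x + c) + (P * P * (- (g * ι) * - (g * ι)) - g * P * (+ 2 * x * ι - 1ℤ)) - g * P
  expand = solve-∀
  collect : ∀ g P j e → g * P + (P * P * (j * j) - g * P * (e * P)) - g * P ≡ (j * j - g * e) * (P * P)
  collect = solve-∀

∤i*i-j*j : ∀ {p} → Prime p → ∀ {i j} → i < j → j ℕ.+ i < p → ¬ + p ℤ.∣ + i * + i - + j * + j
∤i*i-j*j {p} p-prime {i} {j} i<j j+i<p p∣i²-j² =
  Sum.[ p∤j-i , p∤j+i ] (euclidsLemmaℤ (+ j - + i) (+ j + + i) p-prime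
    (subst (+ p ℤ.∣_) (factor (+ i) (+ j)) (ℤ.∣m⇒∣-m p∣i²-j²)))
  where
  factor : ∀ i j → - (i * i - j * j) ≡ (j - i) * (j + i)
  factor = solve-∀
  0<j-i : 0 < j ℕ.∸ i
  0<j-i = ℕ.m<n⇒0<n∸m i<j
  j-i≤j+i : j ℕ.∸ i ℕ.≤ j ℕ.+ i
  j-i≤j+i = ℕ.≤-trans (ℕ.m∸n≤m j i) (ℕ.m≤m+n j i)
  p∤j-i : ¬ + p ℤ.∣ + j - + i
  p∤j-i p∣j-i = >⇒∤ {{ℕ.>-nonZero 0<j-i}} (ℕ.≤-<-trans j-i≤j+i j+i<p)
    (ℤ.∣⇒∣ᵤ (subst (+ p ℤ.∣_) (trans (ℤ.m-n≡m⊖n j i) (ℤ.⊖-≥ (ℕ.<⇒≤ i<j))) p∣j-i))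
  p∤j+i : ¬ + p ℤ.∣ + j + + i
  p∤j+i p∣j+i = >⇒∤ {{ℕ.>-nonZero (ℕ.<-≤-trans 0<j-i j-i≤j+i)}} j+i<p
    (ℤ.∣⇒∣ᵤ (subst (+ p ℤ.∣_) (sym (ℤ.pos-+ j i)) p∣j+i))

%ℕ≡⇒∣- : ∀ {p} .{{_ : ℕ.NonZero p}} x y → x ℤ.%ℕ p ≡ y ℤ.%ℕ p → + p ℤ.∣ x - y
%ℕ≡⇒∣- {p} x y x≡y = divides (x ℤ./ℕ p - y ℤ./ℕ p) (begin
  x - y
    ≡⟨ cong₂ _-_ (ℤ.a≡a%ℕn+[a/ℕn]*n x p) (ℤ.a≡a%ℕn+[a/ℕn]*n y p) ⟩
  (+ (x ℤ.%ℕ p) + x ℤ./ℕ p * + p) - (+ (y ℤ.%ℕ p) + y ℤ./ℕ p * + p)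
    ≡⟨ cong (λ r → (+ r + x ℤ./ℕ p * + p) - (+ (y ℤ.%ℕ p) + y ℤ./ℕ p * + p)) x≡y ⟩
  (+ (y ℤ.%ℕ p) + x ℤ./ℕ p * + p) - (+ (y ℤ.%ℕ p) + y ℤ./ℕ p * + p)
    ≡⟨ cancel (+ (y ℤ.%ℕ p)) (x ℤ./ℕ p) (y ℤ./ℕ p) (+ p) ⟩
  (x ℤ./ℕ p - y ℤ./ℕ p) * + p ∎)
  where
  open ≡-Reasoning
  cancel : ∀ r a b p → (r + a * p) - (r + b * p) ≡ (a - b) * p
  cancel = solve-∀

-- The p + 1 numbers i² and −c − j² (0 ≤ i, j ≤ m) cannot be pairwise distinct modulo p.
x*x+y*y+c-solvable : ∀ {p m} → Prime p → p ≡ suc (m ℕ.+ m) →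
                     ∀ c → ∃₂ λ x y → + p ℤ.∣ x * x + y * y + c
x*x+y*y+c-solvable {p} {m} p-prime refl c =
  collision (splitAt H e) (splitAt H e′) (λ eq → Fin.<⇒≢ e<e′ (splitAt-injective eq))
    (%ℕ≡⇒∣- (value (splitAt H e)) (value (splitAt H e′)) (Fin.fromℕ<-injective _ _ _ _ same))
  where
  instance _ = prime⇒nonZero p-prime
  H : ℕ
  H = suc m

  sq : Fin H → ℤ
  sq i = + toℕ i * + toℕ i

  value : Fin H ⊎ Fin H → ℤ
  value (inj₁ i) = sq i
  value (inj₂ j) = - c - sq j

  residue : Fin (H ℕ.+ H) → Fin p
  residue e = fromℕ< (ℤ.n%ℕd<d (value (splitAt H e)) p)

  p<H+H : p < H ℕ.+ H
  p<H+H = ℕ.s≤s (ℕ.≤-reflexive (sym (ℕ.+-suc m m)))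

  collision-of-residues : ∃₂ λ e e′ → e Fin.< e′ × residue e ≡ residue e′
  collision-of-residues = Fin.pigeonhole p<H+H residue
  e e′ : Fin (H ℕ.+ H)
  e = proj₁ collision-of-residues
  e′ = proj₁ (proj₂ collision-of-residues)
  e<e′ : e Fin.< e′
  e<e′ = proj₁ (proj₂ (proj₂ collision-of-residues))
  same : residue e ≡ residue e′
  same = proj₂ (proj₂ (proj₂ collision-of-residues))

  splitAt-injective : ∀ {e e′} → splitAt H e ≡ splitAt H e′ → e ≡ e′
  splitAt-injective {e} {e′} eq =
    trans (sym (Fin.join-splitAt H H e)) (trans (cong (Fin.join H H) eq) (Fin.join-splitAt H H e′))

  sum<p : ∀ (i j : Fin H) → toℕ i ℕ.+ toℕ j < p
  sum<p i j = ℕ.s≤s (ℕ.+-mono-≤ (ℕ.≤-pred (Fin.toℕ<n i)) (ℕ.≤-pred (Fin.toℕ<n j)))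

  distinct : ∀ (i j : Fin H) → i ≢ j → ¬ + p ℤ.∣ sq i - sq j
  distinct i j i≢j with ℕ.<-cmp (toℕ i) (toℕ j)
  ... | tri< i<j _ _ = ∤i*i-j*j p-prime i<j (sum<p j i)
  ... | tri≈ _ i≡j _ = contradiction (Fin.toℕ-injective i≡j) i≢j
  ... | tri> _ _ j<i = λ p∣ →
    ∤i*i-j*j p-prime j<i (sum<p i j) (subst (+ p ℤ.∣_) (flip (sq i) (sq j)) (ℤ.∣m⇒∣-m p∣))
    where
    flip : ∀ a b → - (a - b) ≡ b - a
    flip = solve-∀

  collision : ∀ u v → u ≢ v → + p ℤ.∣ value u - value v → ∃₂ λ x y → + p ℤ.∣ x * x + y * y + c
  collision (inj₁ i) (inj₁ i′) u≢v p∣ = contradiction p∣ (distinct i i′ (λ eq → u≢v (cong inj₁ eq)))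
  collision (inj₁ i) (inj₂ j) _ p∣ = + toℕ i , + toℕ j , subst (+ p ℤ.∣_) (rearrange (sq i) (sq j) c) p∣
    where
    rearrange : ∀ a b c → a - (- c - b) ≡ a + b + c
    rearrange = solve-∀
  collision (inj₂ j) (inj₁ i) _ p∣ =
    + toℕ i , + toℕ j , subst (+ p ℤ.∣_) (rearrange (sq i) (sq j) c) (ℤ.∣m⇒∣-m p∣)
    where
    rearrange : ∀ a b c → - ((- c - b) - a) ≡ a + b + c
    rearrange = solve-∀
  collision (inj₂ j) (inj₂ j′) u≢v p∣ =
    contradiction (subst (+ p ℤ.∣_) (rearrange (sq j) (sq j′) c) p∣)
                  (distinct j′ j (λ eq → u≢v (cong inj₂ (sym eq))))
    where
    rearrange : ∀ a b c → (- c - a) - (- c - b) ≡ b - a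
    rearrange = solve-∀

p≡3+[p/4]*4 : ∀ {p} → p % 4 ≡ 3 → p ≡ 3 ℕ.+ p ℕ./ 4 ℕ.* 4
p≡3+[p/4]*4 {p} p≡3 = trans (m≡m%n+[m/n]*n p 4) (cong (ℕ._+ p ℕ./ 4 ℕ.* 4) p≡3)

∤2 : ∀ {p} → p % 4 ≡ 3 → ¬ + p ℤ.∣ + 2
∤2 p≡3 p∣2 = >⇒∤ (subst (2 <_) (sym (p≡3+[p/4]*4 p≡3)) (ℕ.s≤s (ℕ.s≤s (ℕ.s≤s ℕ.z≤n))))
                 (ℤ.∣⇒∣ᵤ p∣2)

p≡1+2m : ∀ {p} → p % 4 ≡ 3 → ∃ λ m → p ≡ suc (m ℕ.+ m)
p≡1+2m {p} p≡3 = suc (p ℕ./ 4 ℕ.* 2) , trans (p≡3+[p/4]*4 p≡3) (regroup (p ℕ./ 4))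
  where
  regroup : ∀ q → 3 ℕ.+ q ℕ.* 4 ≡ suc (suc (q ℕ.* 2) ℕ.+ suc (q ℕ.* 2))
  regroup = ℕ-Solver.solve-∀

-- With p = 4q + 3 and p ∣ x² + 1, x^p = x · x² · (x⁴)^q ≡ −x, which contradicts Fermat as p ∤ 2x.
∤x*x+1 : ∀ {p} → Prime p → p % 4 ≡ 3 → ∀ x → ¬ + p ℤ.∣ x * x + 1ℤ
∤x*x+1 {p} p-prime p≡3 x p∣x²+1 = Sum.[ ∤2 p≡3 , p∤x ] (euclidsLemmaℤ (+ 2) x p-prime p∣2x)
  where
  q : ℕ
  q = p ℕ./ 4
  y : ℤ
  y = x * x
  p∤x : ¬ + p ℤ.∣ x
  p∤x p∣x = prime∤1 p-prime (ℤ.∣m+n∣m⇒∣n p∣x²+1 (ℤ.∣m⇒∣m*n x p∣x))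
  p∣y²-1 : + p ℤ.∣ y * y - 1ℤ
  p∣y²-1 = subst (_ ℤ.∣_) (difference-of-squares y) (ℤ.∣m⇒∣m*n (y - 1ℤ) p∣x²+1)
    where
    difference-of-squares : ∀ y → (y + 1ℤ) * (y - 1ℤ) ≡ y * y - 1ℤ
    difference-of-squares = solve-∀
  p∣W-1 : + p ℤ.∣ (y * y) ^ q - 1ℤ
  p∣W-1 = subst (λ z → + p ℤ.∣ (y * y) ^ q - z) (ℤ.^-zeroˡ q) (∣a-b⇒∣aⁿ-bⁿ p∣y²-1 q)
  x^p : x ^ p ≡ x * y * (y * y) ^ q
  x^p = begin
    x ^ p                 ≡⟨ cong (x ^_) (p≡3+[p/4]*4 {p} p≡3) ⟩
    x ^ (3 ℕ.+ q ℕ.* 4)   ≡⟨ ℤ.^-distribˡ-+-* x 3 (q ℕ.* 4) ⟩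
    x ^ 3 * x ^ (q ℕ.* 4) ≡⟨ cong (x ^ 3 *_) (trans (cong (x ^_) (ℕ.*-comm q 4)) (sym (ℤ.^-*-assoc x 4 q))) ⟩
    x ^ 3 * (x ^ 4) ^ q   ≡⟨ cong₂ (λ u v → u * v ^ q) (cube x) (fourth x) ⟩
    x * y * (y * y) ^ q   ∎
    where
    open ≡-Reasoning
    cube : ∀ x → x * (x * (x * 1ℤ)) ≡ x * (x * x)
    cube = solve-∀
    fourth : ∀ x → x * (x * (x * (x * 1ℤ))) ≡ x * x * (x * x)
    fourth = solve-∀
  p∣2x : + p ℤ.∣ + 2 * x
  p∣2x = subst (+ p ℤ.∣_) (rearrange x y ((y * y) ^ q))
    (ℤ.∣m∣n⇒∣m-n (ℤ.∣m∣n⇒∣m+n (ℤ.∣n⇒∣m*n (x * y) p∣W-1) (ℤ.∣n⇒∣m*n x p∣x²+1))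
                 (subst (λ z → + p ℤ.∣ z - x) x^p (fermat p-prime x)))
    where
    rearrange : ∀ x y W → x * y * (W - 1ℤ) + x * (y + 1ℤ) - (x * y * W - x) ≡ + 2 * x
    rearrange = solve-∀

∣x*x+y*y⇒∣y : ∀ {p} → Prime p → p % 4 ≡ 3 → ∀ x y → + p ℤ.∣ x * x + y * y → + p ℤ.∣ y
∣x*x+y*y⇒∣y {p} p-prime p≡3 x y p∣x²+y² with + p ℤ.∣? y
... | yes p∣y = p∣y
... | no p∤y with mod-inverse p-prime y p∤y
...   | ι , p∣yι-1 = contradiction p∣[xι]²+1 (∤x*x+1 p-prime p≡3 (x * ι))
  where
  scaled : ∀ x y ι → ι * ι * (x * x + y * y) - (y * ι + 1ℤ) * (y * ι - 1ℤ) ≡ x * ι * (x * ι) + 1ℤ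
  scaled = solve-∀
  p∣[xι]²+1 : + p ℤ.∣ x * ι * (x * ι) + 1ℤ
  p∣[xι]²+1 = subst (+ p ℤ.∣_) (scaled x y ι)
    (ℤ.∣m∣n⇒∣m-n (ℤ.∣n⇒∣m*n (ι * ι) p∣x²+y²) (ℤ.∣n⇒∣m*n (y * ι + 1ℤ) p∣yι-1))

∣x*x+y*y⇒∣x : ∀ {p} → Prime p → p % 4 ≡ 3 → ∀ x y → + p ℤ.∣ x * x + y * y → + p ℤ.∣ x
∣x*x+y*y⇒∣x p-prime p≡3 x y p∣x²+y² =
  ∣x*x+y*y⇒∣y p-prime p≡3 y x (subst (_ ℤ.∣_) (ℤ.+-comm (x * x) (y * y)) p∣x²+y²)

-- Finite sums, matrices and the form x² + y² + A z²

sumℤ-cong : ∀ {n} {f g : Fin n → ℤ} → (∀ i → f i ≡ g i) → sumℤ f ≡ sumℤ g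
sumℤ-cong {zero} f≡g = refl
sumℤ-cong {suc n} f≡g = cong₂ _+_ (f≡g zero) (sumℤ-cong (λ i → f≡g (suc i)))

*-distribˡ-sumℤ : ∀ {n} c (f : Fin n → ℤ) → c * sumℤ f ≡ sumℤ (λ i → c * f i)
*-distribˡ-sumℤ {zero} c f = ℤ.*-zeroʳ c
*-distribˡ-sumℤ {suc n} c f =
  trans (ℤ.*-distribˡ-+ c (f zero) _) (cong (λ s → c * f zero + s) (*-distribˡ-sumℤ c (λ i → f (suc i))))

*-distribʳ-sumℤ : ∀ {n} c (f : Fin n → ℤ) → sumℤ f * c ≡ sumℤ (λ i → f i * c)
*-distribʳ-sumℤ c f = trans (ℤ.*-comm _ c) (trans (*-distribˡ-sumℤ c f) (sumℤ-cong (λ i → ℤ.*-comm c (f i))))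

sumℤ-distrib-+ : ∀ {n} (f g : Fin n → ℤ) → sumℤ (λ i → f i + g i) ≡ sumℤ f + sumℤ g
sumℤ-distrib-+ {zero} f g = refl
sumℤ-distrib-+ {suc n} f g =
  trans (cong (λ s → f zero + g zero + s) (sumℤ-distrib-+ (λ i → f (suc i)) (λ i → g (suc i))))
        (interchange (f zero) (g zero) _ _)
  where
  interchange : ∀ a b c d → a + b + (c + d) ≡ a + c + (b + d)
  interchange = solve-∀

sumℤ-comm : ∀ {m n} (f : Fin m → Fin n → ℤ) →
            sumℤ (λ i → sumℤ (λ j → f i j)) ≡ sumℤ (λ j → sumℤ (λ i → f i j))
sumℤ-comm {zero} {n} f = sym (sumℤ-zero n)
  where
  sumℤ-zero : ∀ n → sumℤ {n} (λ _ → 0ℤ) ≡ 0ℤ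
  sumℤ-zero zero = refl
  sumℤ-zero (suc n) = trans (ℤ.+-identityˡ _) (sumℤ-zero n)
sumℤ-comm {suc m} f =
  trans (cong (λ s → sumℤ (f zero) + s) (sumℤ-comm (λ i → f (suc i))))
        (sym (sumℤ-distrib-+ (f zero) (λ j → sumℤ (λ i → f (suc i) j))))

sumℤ-comm₂ : ∀ {m n k l} (f : Fin m → Fin n → Fin k → Fin l → ℤ) →
  sumℤ (λ i → sumℤ (λ j → sumℤ (λ r → sumℤ (λ s → f i j r s)))) ≡
  sumℤ (λ r → sumℤ (λ s → sumℤ (λ i → sumℤ (λ j → f i j r s))))
sumℤ-comm₂ f = begin
  sumℤ (λ i → sumℤ (λ j → sumℤ (λ r → sumℤ (λ s → f i j r s))))
    ≡⟨ sumℤ-cong (λ i → sumℤ-comm (λ j r → sumℤ (λ s → f i j r s))) ⟩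
  sumℤ (λ i → sumℤ (λ r → sumℤ (λ j → sumℤ (λ s → f i j r s))))
    ≡⟨ sumℤ-comm (λ i r → sumℤ (λ j → sumℤ (λ s → f i j r s))) ⟩
  sumℤ (λ r → sumℤ (λ i → sumℤ (λ j → sumℤ (λ s → f i j r s))))
    ≡⟨ sumℤ-cong (λ r → sumℤ-cong (λ i → sumℤ-comm (λ j s → f i j r s))) ⟩
  sumℤ (λ r → sumℤ (λ i → sumℤ (λ s → sumℤ (λ j → f i j r s))))
    ≡⟨ sumℤ-cong (λ r → sumℤ-comm (λ i s → sumℤ (λ j → f i j r s))) ⟩
  sumℤ (λ r → sumℤ (λ s → sumℤ (λ i → sumℤ (λ j → f i j r s)))) ∎
  where open ≡-Reasoning

sumℤ-*-sumℤ : ∀ {m n} (f : Fin m → ℤ) c (g : Fin n → ℤ) →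
              sumℤ f * c * sumℤ g ≡ sumℤ (λ i → sumℤ (λ j → f i * c * g j))
sumℤ-*-sumℤ f c g = begin
  sumℤ f * c * sumℤ g                         ≡⟨ cong (_* sumℤ g) (*-distribʳ-sumℤ c f) ⟩
  sumℤ (λ i → f i * c) * sumℤ g               ≡⟨ *-distribʳ-sumℤ (sumℤ g) (λ i → f i * c) ⟩
  sumℤ (λ i → f i * c * sumℤ g)               ≡⟨ sumℤ-cong (λ i → *-distribˡ-sumℤ (f i * c) g) ⟩
  sumℤ (λ i → sumℤ (λ j → f i * c * g j))     ∎
  where open ≡-Reasoning

*-distrib-sumℤ² : ∀ {m n} a (f : Fin m → Fin n → ℤ) b →
                  a * sumℤ (λ i → sumℤ (λ j → f i j)) * b ≡ sumℤ (λ i → sumℤ (λ j → a * f i j * b))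
*-distrib-sumℤ² a f b = begin
  a * sumℤ (λ i → sumℤ (f i)) * b
    ≡⟨ cong (_* b) (trans (*-distribˡ-sumℤ a (λ i → sumℤ (f i)))
                          (sumℤ-cong (λ i → *-distribˡ-sumℤ a (f i)))) ⟩
  sumℤ (λ i → sumℤ (λ j → a * f i j)) * b
    ≡⟨ trans (*-distribʳ-sumℤ b (λ i → sumℤ (λ j → a * f i j)))
             (sumℤ-cong (λ i → *-distribʳ-sumℤ b (λ j → a * f i j))) ⟩
  sumℤ (λ i → sumℤ (λ j → a * f i j * b)) ∎
  where open ≡-Reasoning

sumℤ²-*ˡ : ∀ {m n} c (f : Fin m → Fin n → ℤ) →
           sumℤ (λ i → sumℤ (λ j → c * f i j)) ≡ c * sumℤ (λ i → sumℤ (λ j → f i j))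
sumℤ²-*ˡ c f =
  sym (trans (*-distribˡ-sumℤ c (λ i → sumℤ (f i))) (sumℤ-cong (λ i → *-distribˡ-sumℤ c (f i))))

infixr 7 _*ᵥ_
_*ᵥ_ : Mat3 → Vec3 → Vec3
(M *ᵥ x) i = sumℤ (λ j → M i j * x j)

evalQF-congruent : ∀ A M x → evalQF (congruent M A) x ≡ evalQF A (M *ᵥ x)
evalQF-congruent A M x = begin
  sumℤ (λ i → sumℤ (λ j → x i * sumℤ (λ k → sumℤ (λ l → M k i * A k l * M l j)) * x j))
    ≡⟨ sumℤ-cong (λ i → sumℤ-cong (λ j → trans (*-distrib-sumℤ² (x i) (λ k l → M k i * A k l * M l j) (x j))
         (sumℤ-cong (λ k → sumℤ-cong (λ l → regroup (x i) (M k i) (A k l) (M l j) (x j)))))) ⟩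
  sumℤ (λ i → sumℤ (λ j → sumℤ (λ k → sumℤ (λ l → M k i * x i * A k l * (M l j * x j)))))
    ≡⟨ sumℤ-comm₂ (λ i j k l → M k i * x i * A k l * (M l j * x j)) ⟩
  sumℤ (λ k → sumℤ (λ l → sumℤ (λ i → sumℤ (λ j → M k i * x i * A k l * (M l j * x j)))))
    ≡⟨ sumℤ-cong (λ k → sumℤ-cong (λ l →
         sym (sumℤ-*-sumℤ (λ i → M k i * x i) (A k l) (λ j → M l j * x j)))) ⟩
  sumℤ (λ k → sumℤ (λ l → (M *ᵥ x) k * A k l * (M *ᵥ x) l)) ∎
  where
  open ≡-Reasoning
  regroup : ∀ x m a n y → x * (m * a * n) * y ≡ m * x * a * (n * y)
  regroup = solve-∀

congruent-scale : ∀ y T A i j → congruent (λ k l → y * T k l) A i j ≡ y * y * congruent T A i j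
congruent-scale y T A i j = trans
  (sumℤ-cong (λ k → sumℤ-cong (λ l → regroup y (T k i) (A k l) (T l j))))
  (sumℤ²-*ˡ (y * y) (λ k l → T k i * A k l * T l j))
  where
  regroup : ∀ y t a s → y * t * a * (y * s) ≡ y * y * (t * a * s)
  regroup = solve-∀

evalQF-scale : ∀ c A x → evalQF (λ i j → c * A i j) x ≡ c * evalQF A x
evalQF-scale c A x = trans
  (sumℤ-cong (λ i → sumℤ-cong (λ j → regroup c (x i) (A i j) (x j))))
  (sumℤ²-*ˡ c (λ i j → x i * A i j * x j))
  where
  regroup : ∀ c x a y → x * (c * a) * y ≡ c * (x * a * y)
  regroup = solve-∀

β : ℤ → Vec3 → Vec3 → ℤ
β A x y = x 0F * y 0F + x 1F * y 1F + A * (x 2F * y 2F)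

Q : ℤ → Vec3 → ℤ
Q A x = β A x x

column : Mat3 → Fin 3 → Vec3
column M j i = M i j

diag11a-bilinear : ∀ a x y → sumℤ (λ k → sumℤ (λ l → x k * diag11a a k l * y l)) ≡ β (+ a) x y
diag11a-bilinear a x y = expand (x 0F) (x 1F) (x 2F) (y 0F) (y 1F) (y 2F) (+ a)
  where
  expand : ∀ x₀ x₁ x₂ y₀ y₁ y₂ A →
      (x₀ * 1ℤ * y₀ + (x₀ * 0ℤ * y₁ + (x₀ * 0ℤ * y₂ + 0ℤ)))
    + ((x₁ * 0ℤ * y₀ + (x₁ * 1ℤ * y₁ + (x₁ * 0ℤ * y₂ + 0ℤ)))
    + ((x₂ * 0ℤ * y₀ + (x₂ * 0ℤ * y₁ + (x₂ * A * y₂ + 0ℤ))) + 0ℤ))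
    ≡ x₀ * y₀ + x₁ * y₁ + A * (x₂ * y₂)
  expand = solve-∀

evalQF-diag11a : ∀ a x → evalQF (diag11a a) x ≡ Q (+ a) x
evalQF-diag11a a x = diag11a-bilinear a x x

congruent-diag11a : ∀ a M i j → congruent M (diag11a a) i j ≡ β (+ a) (column M i) (column M j)
congruent-diag11a a M i j = diag11a-bilinear a (column M i) (column M j)

det3-scale : ∀ y M → det3 (λ i j → y * M i j) ≡ y * y * y * det3 M
det3-scale y M = expand y (M 0F 0F) (M 0F 1F) (M 0F 2F) (M 1F 0F) (M 1F 1F) (M 1F 2F) (M 2F 0F) (M 2F 1F) (M 2F 2F)
  where
  expand : ∀ y m₀₀ m₀₁ m₀₂ m₁₀ m₁₁ m₁₂ m₂₀ m₂₁ m₂₂ →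
      y * m₀₀ * (y * m₁₁ * (y * m₂₂) - y * m₁₂ * (y * m₂₁))
    - y * m₀₁ * (y * m₁₀ * (y * m₂₂) - y * m₁₂ * (y * m₂₀))
    + y * m₀₂ * (y * m₁₀ * (y * m₂₁) - y * m₁₁ * (y * m₂₀))
    ≡ y * y * y
      * (m₀₀ * (m₁₁ * m₂₂ - m₁₂ * m₂₁) - m₀₁ * (m₁₀ * m₂₂ - m₁₂ * m₂₀) + m₀₂ * (m₁₀ * m₂₁ - m₁₁ * m₂₀))
  expand = solve-∀

∣*ᵥ⇒∣det3*x₂ : ∀ {d} M x → (∀ i → d ℤ.∣ (M *ᵥ x) i) → d ℤ.∣ det3 M * x 2F
∣*ᵥ⇒∣det3*x₂ M x d∣Mx = subst (_ ℤ.∣_)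
  (sym (cramer (M 0F 0F) (M 0F 1F) (M 0F 2F) (M 1F 0F) (M 1F 1F) (M 1F 2F) (M 2F 0F) (M 2F 1F) (M 2F 2F)
               (x 0F) (x 1F) (x 2F)))
  (ℤ.∣m∣n⇒∣m+n (ℤ.∣m∣n⇒∣m+n (ℤ.∣n⇒∣m*n c₀ (d∣Mx 0F)) (ℤ.∣n⇒∣m*n c₁ (d∣Mx 1F)))
               (ℤ.∣n⇒∣m*n c₂ (d∣Mx 2F)))
  where
  c₀ c₁ c₂ : ℤ
  c₀ = M 1F 0F * M 2F 1F - M 1F 1F * M 2F 0F
  c₁ = M 0F 1F * M 2F 0F - M 0F 0F * M 2F 1F
  c₂ = M 0F 0F * M 1F 1F - M 0F 1F * M 1F 0F
  cramer : ∀ m₀₀ m₀₁ m₀₂ m₁₀ m₁₁ m₁₂ m₂₀ m₂₁ m₂₂ x₀ x₁ x₂ →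
      (m₀₀ * (m₁₁ * m₂₂ - m₁₂ * m₂₁) - m₀₁ * (m₁₀ * m₂₂ - m₁₂ * m₂₀) + m₀₂ * (m₁₀ * m₂₁ - m₁₁ * m₂₀))
      * x₂
    ≡ (m₁₀ * m₂₁ - m₁₁ * m₂₀) * (m₀₀ * x₀ + (m₀₁ * x₁ + (m₀₂ * x₂ + 0ℤ)))
    + (m₀₁ * m₂₀ - m₀₀ * m₂₁) * (m₁₀ * x₀ + (m₁₁ * x₁ + (m₁₂ * x₂ + 0ℤ)))
    + (m₀₀ * m₁₁ - m₀₁ * m₁₀) * (m₂₀ * x₀ + (m₂₁ * x₁ + (m₂₂ * x₂ + 0ℤ)))
  cramer = solve-∀

x*x≡+∣x∣*∣x∣ : ∀ x → x * x ≡ + (∣ x ∣ ℕ.* ∣ x ∣)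
x*x≡+∣x∣*∣x∣ (+ n) = sym (ℤ.pos-* n n)
x*x≡+∣x∣*∣x∣ -[1+ n ] = refl

Qℕ : ℕ → Vec3 → ℕ
Qℕ a x = ∣ x 0F ∣ ℕ.* ∣ x 0F ∣ ℕ.+ ∣ x 1F ∣ ℕ.* ∣ x 1F ∣ ℕ.+ a ℕ.* (∣ x 2F ∣ ℕ.* ∣ x 2F ∣)

Q≡+Qℕ : ∀ a x → Q (+ a) x ≡ + Qℕ a x
Q≡+Qℕ a x = cong₂ _+_ (cong₂ _+_ (x*x≡+∣x∣*∣x∣ (x 0F)) (x*x≡+∣x∣*∣x∣ (x 1F)))
                      (trans (cong (+ a *_) (x*x≡+∣x∣*∣x∣ (x 2F))) (sym (ℤ.pos-* a _)))

0<∣z∣*∣z∣ : ∀ {z} → z ≢ 0ℤ → 0 < ∣ z ∣ ℕ.* ∣ z ∣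
0<∣z∣*∣z∣ {z} z≢0 = ℕ.*-mono-< 0<∣z∣ 0<∣z∣
  where
  0<∣z∣ : 0 < ∣ z ∣
  0<∣z∣ = ℕ.n≢0⇒n>0 (λ ∣z∣≡0 → z≢0 (ℤ.∣i∣≡0⇒i≡0 ∣z∣≡0))

Qℕ-positive : ∀ {a} x → 0 < a → (Σ (Fin 3) λ i → x i ≢ 0ℤ) → 0 < Qℕ a x
Qℕ-positive x 0<a (0F , x₀≢0) =
  ℕ.<-≤-trans (0<∣z∣*∣z∣ x₀≢0) (ℕ.≤-trans (ℕ.m≤m+n _ _) (ℕ.m≤m+n _ _))
Qℕ-positive {a} x 0<a (1F , x₁≢0) =
  ℕ.<-≤-trans (0<∣z∣*∣z∣ x₁≢0)
    (ℕ.≤-trans (ℕ.m≤n+m _ (∣ x 0F ∣ ℕ.* ∣ x 0F ∣)) (ℕ.m≤m+n _ (a ℕ.* (∣ x 2F ∣ ℕ.* ∣ x 2F ∣))))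
Qℕ-positive x 0<a (2F , x₂≢0) =
  ℕ.<-≤-trans (ℕ.*-mono-< 0<a (0<∣z∣*∣z∣ x₂≢0)) (ℕ.m≤n+m _ _)

0<Q : ∀ {a} x → 0 < a → (Σ (Fin 3) λ i → x i ≢ 0ℤ) → 0ℤ ℤ.< Q (+ a) x
0<Q {a} x 0<a x≢0 = subst (0ℤ ℤ.<_) (sym (Q≡+Qℕ a x)) (ℤ.+<+ (Qℕ-positive x 0<a x≢0))

β-comm : ∀ A x y → β A x y ≡ β A y x
β-comm A x y = swap (x 0F) (x 1F) (x 2F) (y 0F) (y 1F) (y 2F) A
  where
  swap : ∀ x₀ x₁ x₂ y₀ y₁ y₂ A →
         x₀ * y₀ + x₁ * y₁ + A * (x₂ * y₂) ≡ y₀ * x₀ + y₁ * x₁ + A * (y₂ * x₂)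
  swap = solve-∀

evalQF-cong : ∀ {A A′} x → (∀ i j → A i j ≡ A′ i j) → evalQF A x ≡ evalQF A′ x
evalQF-cong x A≡A′ = sumℤ-cong (λ i → sumℤ-cong (λ j → cong (λ z → x i * z * x j) (A≡A′ i j)))

Q-cong : ∀ A {x y} → (∀ i → x i ≡ y i) → Q A x ≡ Q A y
Q-cong A x≡y = cong₂ _+_ (cong₂ _+_ (cong₂ _*_ (x≡y 0F) (x≡y 0F)) (cong₂ _*_ (x≡y 1F) (x≡y 1F)))
                         (cong (A *_) (cong₂ _*_ (x≡y 2F) (x≡y 2F)))

Q-scale : ∀ A c x → Q A (λ i → c * x i) ≡ c * c * Q A x
Q-scale A c x = expand A c (x 0F) (x 1F) (x 2F)
  where
  expand : ∀ A c x₀ x₁ x₂ → c * x₀ * (c * x₀) + c * x₁ * (c * x₁) + A * (c * x₂ * (c * x₂))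
                          ≡ c * c * (x₀ * x₀ + x₁ * x₁ + A * (x₂ * x₂))
  expand = solve-∀

∣det*x⇒∣x : ∀ {d det x} → ∣ det ∣ ≡ 1 → d ℤ.∣ det * x → d ℤ.∣ x
∣det*x⇒∣x {d} {det} {x} ∣det∣≡1 d∣det*x =
  ℤ.∣ᵤ⇒∣ (subst (∣ d ∣ ℕ.∣_) (trans (ℤ.abs-* det x) (trans (cong (ℕ._* ∣ x ∣) ∣det∣≡1) (ℕ.*-identityˡ ∣ x ∣)))
                             (ℤ.∣⇒∣ᵤ d∣det*x))

isometricℤAt-scaled : ∀ {q} → Prime q → ∀ A B T d → (∀ i j → congruent T A i j ≡ d * d * B i j) →
                      ¬ + q ℤ.∣ d → ¬ + q ℤ.∣ det3 T → IsometricℤAt q A B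
isometricℤAt-scaled {q} q-prime A B T d gram q∤d q∤detT K =
  M , q∤detM ∘ ℤ.∣ᵤ⇒∣ , λ i j → ℤ.∣⇒∣ᵤ (qᴷ∣MᵀAM-B i j)
  where
  ι : ℤ
  ι = proj₁ (mod-inverse q-prime d q∤d)
  q∣1-dι : + q ℤ.∣ 1ℤ - d * ι
  q∣1-dι = subst (+ q ℤ.∣_) (negate (d * ι)) (ℤ.∣m⇒∣-m (proj₂ (mod-inverse q-prime d q∤d)))
    where
    negate : ∀ x → - (x - 1ℤ) ≡ 1ℤ - x
    negate = solve-∀
  y : ℤ
  y = proj₁ (mod-inverse-power d ι q∣1-dι K)
  qᴷ⁺¹∣1-dy : + (q ℕ.^ suc K) ℤ.∣ 1ℤ - d * y
  qᴷ⁺¹∣1-dy = proj₂ (mod-inverse-power d ι q∣1-dι K)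
  q∣1-dy : + q ℤ.∣ 1ℤ - d * y
  q∣1-dy = ℤ.∣-trans (ℤ.∣ᵤ⇒∣ (ℕ.m∣m*n (q ℕ.^ K))) qᴷ⁺¹∣1-dy
  qᴷ∣1-dy : + (q ℕ.^ K) ℤ.∣ 1ℤ - d * y
  qᴷ∣1-dy = ℤ.∣-trans (ℤ.∣ᵤ⇒∣ (ℕ.n∣m*n q)) qᴷ⁺¹∣1-dy
  q∤y : ¬ + q ℤ.∣ y
  q∤y q∣y = prime∤1 q-prime (subst (+ q ℤ.∣_) (cancel d y) (ℤ.∣m∣n⇒∣m+n q∣1-dy (ℤ.∣n⇒∣m*n d q∣y)))
    where
    cancel : ∀ d y → 1ℤ - d * y + d * y ≡ 1ℤ
    cancel = solve-∀
  M : Mat3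
  M i j = y * T i j
  q∤detM : ¬ + q ℤ.∣ det3 M
  q∤detM = subst (λ z → ¬ + q ℤ.∣ z) (sym (det3-scale y T))
    (∤*∤⇒∤* q-prime (∤*∤⇒∤* q-prime (∤*∤⇒∤* q-prime q∤y q∤y) q∤y) q∤detT)
  qᴷ∣MᵀAM-B : ∀ i j → + (q ℕ.^ K) ℤ.∣ congruent M A i j - B i j
  qᴷ∣MᵀAM-B i j = subst (+ (q ℕ.^ K) ℤ.∣_) (sym MᵀAM-B≡)
    (ℤ.∣m⇒∣-m (ℤ.∣m⇒∣m*n (B i j) (ℤ.∣m⇒∣m*n (1ℤ + d * y) qᴷ∣1-dy)))
    where
    factor : ∀ y d b → y * y * (d * d * b) - b ≡ - ((1ℤ - d * y) * (1ℤ + d * y) * b)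
    factor = solve-∀
    MᵀAM-B≡ : congruent M A i j - B i j ≡ - ((1ℤ - d * y) * (1ℤ + d * y) * B i j)
    MᵀAM-B≡ = trans (cong (_- B i j) (trans (congruent-scale y T A i j) (cong (y * y *_) (gram i j))))
                    (factor y d (B i j))

-- The lattice of a vector isotropic modulo p²

-- u₂ and A are defined from the free parameters so that Q_A(u) = P² h and β_A(u, (r, 1, 0)) = P k
-- hold by construction and every identity below is a polynomial identity.
module Lattice (P u₁ r k h : ℤ) where

  u₂ : ℤ
  u₂ = P * k - u₁ * r

  A : ℤ
  A = P * P * h - u₁ * u₁ - u₂ * u₂

  u : Vec3
  u = u₁ ∷ u₂ ∷ 1ℤ ∷ []

  B : Mat3
  B = (h  ∷ k          ∷ u₁    ∷ [])
    ∷ (k  ∷ r * r + 1ℤ ∷ P * r ∷ [])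
    ∷ (u₁ ∷ P * r      ∷ P * P ∷ [])
    ∷ []

  T₁ : Mat3
  T₁ = (u₁ ∷ P * r ∷ P * P ∷ [])
     ∷ (u₂ ∷ P     ∷ 0ℤ    ∷ [])
     ∷ (1ℤ ∷ 0ℤ    ∷ 0ℤ    ∷ [])
     ∷ []

  c : ℤ
  c = P * h + + 2 * u₁ + P

  -- T₂ = (c / P) τ_v T₁, where τ_v is the reflection in v = u + P e₀ and Q_A(v) = P c; unlike T₁ / P
  -- it is integral, and its determinant c³ is prime to P in the situation of Lift.
  T₂ : Mat3
  T₂ = ((1ℤ - h) * u₁ - + 2 * (P * h + u₁)
         ∷ c * r - + 2 * (k + r) * (u₁ + P)
         ∷ c * P - + 2 * (u₁ + P) * (u₁ + P) ∷ [])
     ∷ ((1ℤ - h) * u₂ ∷ c - + 2 * (k + r) * u₂ ∷ - (+ 2 * (u₁ + P) * u₂) ∷ [])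
     ∷ (1ℤ - h        ∷ - (+ 2 * (k + r))     ∷ - (+ 2 * (u₁ + P))      ∷ [])
     ∷ []

  ξ : Vec3 → Vec3
  ξ w = P * P * w 2F ∷ P * (w 1F - u₂ * w 2F) ∷ w 0F - u₁ * w 2F - r * w 1F + r * u₂ * w 2F ∷ []

  gram-T₁ : ∀ i j → β A (column T₁ i) (column T₁ j) ≡ P * P * B i j
  gram-T₁ i j = entries i j
    where
    e₀₀ : ∀ P u₁ r k h →
        u₁ * u₁
        + (P * k - u₁ * r) * (P * k - u₁ * r)
        + (P * P * h - u₁ * u₁ - (P * k - u₁ * r) * (P * k - u₁ * r)) * (1ℤ * 1ℤ)
      ≡ P * P * h
    e₀₀ = solve-∀
    e₀₁ : ∀ P u₁ r k h →
        u₁ * (P * r)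
        + (P * k - u₁ * r) * P
        + (P * P * h - u₁ * u₁ - (P * k - u₁ * r) * (P * k - u₁ * r)) * (1ℤ * 0ℤ)
      ≡ P * P * k
    e₀₁ = solve-∀
    e₀₂ : ∀ P u₁ r k h →
        u₁ * (P * P)
        + (P * k - u₁ * r) * 0ℤ
        + (P * P * h - u₁ * u₁ - (P * k - u₁ * r) * (P * k - u₁ * r)) * (1ℤ * 0ℤ)
      ≡ P * P * u₁
    e₀₂ = solve-∀
    e₁₁ : ∀ P u₁ r k h →
        P * r * (P * r)
        + P * P
        + (P * P * h - u₁ * u₁ - (P * k - u₁ * r) * (P * k - u₁ * r)) * (0ℤ * 0ℤ)
      ≡ P * P * (r * r + 1ℤ)
    e₁₁ = solve-∀
    e₁₂ : ∀ P u₁ r k h →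
        P * r * (P * P)
        + P * 0ℤ
        + (P * P * h - u₁ * u₁ - (P * k - u₁ * r) * (P * k - u₁ * r)) * (0ℤ * 0ℤ)
      ≡ P * P * (P * r)
    e₁₂ = solve-∀
    e₂₂ : ∀ P u₁ r k h →
        P * P * (P * P)
        + 0ℤ * 0ℤ
        + (P * P * h - u₁ * u₁ - (P * k - u₁ * r) * (P * k - u₁ * r)) * (0ℤ * 0ℤ)
      ≡ P * P * (P * P)
    e₂₂ = solve-∀
    entries : ∀ i j → β A (column T₁ i) (column T₁ j) ≡ P * P * B i j
    entries 0F 0F = e₀₀ P u₁ r k h
    entries 0F 1F = e₀₁ P u₁ r k h
    entries 0F 2F = e₀₂ P u₁ r k h
    entries 1F 1F = e₁₁ P u₁ r k h
    entries 1F 2F = e₁₂ P u₁ r k h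
    entries 2F 2F = e₂₂ P u₁ r k h
    entries 1F 0F = trans (β-comm A (column T₁ 1F) (column T₁ 0F)) (entries 0F 1F)
    entries 2F 0F = trans (β-comm A (column T₁ 2F) (column T₁ 0F)) (entries 0F 2F)
    entries 2F 1F = trans (β-comm A (column T₁ 2F) (column T₁ 1F)) (entries 1F 2F)

  gram-T₂ : ∀ i j → β A (column T₂ i) (column T₂ j) ≡ c * c * B i j
  gram-T₂ i j = entries i j
    where
    e₀₀ : ∀ P u₁ r k h →
        ((1ℤ - h) * u₁ - + 2 * (P * h + u₁)) * ((1ℤ - h) * u₁ - + 2 * (P * h + u₁))
        + (1ℤ - h) * (P * k - u₁ * r) * ((1ℤ - h) * (P * k - u₁ * r))
        + (P * P * h - u₁ * u₁ - (P * k - u₁ * r) * (P * k - u₁ * r)) * ((1ℤ - h) * (1ℤ - h))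
      ≡ (P * h + + 2 * u₁ + P) * (P * h + + 2 * u₁ + P) * h
    e₀₀ = solve-∀
    e₀₁ : ∀ P u₁ r k h →
        ((1ℤ - h) * u₁ - + 2 * (P * h + u₁))
          * ((P * h + + 2 * u₁ + P) * r - + 2 * (k + r) * (u₁ + P))
        + (1ℤ - h)
          * (P * k - u₁ * r)
          * (P * h + + 2 * u₁ + P - + 2 * (k + r) * (P * k - u₁ * r))
        + (P * P * h - u₁ * u₁ - (P * k - u₁ * r) * (P * k - u₁ * r))
          * ((1ℤ - h) * - (+ 2 * (k + r)))
      ≡ (P * h + + 2 * u₁ + P) * (P * h + + 2 * u₁ + P) * k
    e₀₁ = solve-∀
    e₀₂ : ∀ P u₁ r k h →
        ((1ℤ - h) * u₁ - + 2 * (P * h + u₁))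
          * ((P * h + + 2 * u₁ + P) * P - + 2 * (u₁ + P) * (u₁ + P))
        + (1ℤ - h) * (P * k - u₁ * r) * - (+ 2 * (u₁ + P) * (P * k - u₁ * r))
        + (P * P * h - u₁ * u₁ - (P * k - u₁ * r) * (P * k - u₁ * r))
          * ((1ℤ - h) * - (+ 2 * (u₁ + P)))
      ≡ (P * h + + 2 * u₁ + P) * (P * h + + 2 * u₁ + P) * u₁
    e₀₂ = solve-∀
    e₁₁ : ∀ P u₁ r k h →
        ((P * h + + 2 * u₁ + P) * r - + 2 * (k + r) * (u₁ + P))
          * ((P * h + + 2 * u₁ + P) * r - + 2 * (k + r) * (u₁ + P))
        + (P * h + + 2 * u₁ + P - + 2 * (k + r) * (P * k - u₁ * r))
          * (P * h + + 2 * u₁ + P - + 2 * (k + r) * (P * k - u₁ * r))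
        + (P * P * h - u₁ * u₁ - (P * k - u₁ * r) * (P * k - u₁ * r))
          * (- (+ 2 * (k + r)) * - (+ 2 * (k + r)))
      ≡ (P * h + + 2 * u₁ + P) * (P * h + + 2 * u₁ + P) * (r * r + 1ℤ)
    e₁₁ = solve-∀
    e₁₂ : ∀ P u₁ r k h →
        ((P * h + + 2 * u₁ + P) * r - + 2 * (k + r) * (u₁ + P))
          * ((P * h + + 2 * u₁ + P) * P - + 2 * (u₁ + P) * (u₁ + P))
        + (P * h + + 2 * u₁ + P - + 2 * (k + r) * (P * k - u₁ * r))
          * - (+ 2 * (u₁ + P) * (P * k - u₁ * r))
        + (P * P * h - u₁ * u₁ - (P * k - u₁ * r) * (P * k - u₁ * r))
          * (- (+ 2 * (k + r)) * - (+ 2 * (u₁ + P)))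
      ≡ (P * h + + 2 * u₁ + P) * (P * h + + 2 * u₁ + P) * (P * r)
    e₁₂ = solve-∀
    e₂₂ : ∀ P u₁ r k h →
        ((P * h + + 2 * u₁ + P) * P - + 2 * (u₁ + P) * (u₁ + P))
          * ((P * h + + 2 * u₁ + P) * P - + 2 * (u₁ + P) * (u₁ + P))
        + - (+ 2 * (u₁ + P) * (P * k - u₁ * r)) * - (+ 2 * (u₁ + P) * (P * k - u₁ * r))
        + (P * P * h - u₁ * u₁ - (P * k - u₁ * r) * (P * k - u₁ * r))
          * (- (+ 2 * (u₁ + P)) * - (+ 2 * (u₁ + P)))
      ≡ (P * h + + 2 * u₁ + P) * (P * h + + 2 * u₁ + P) * (P * P)
    e₂₂ = solve-∀
    entries : ∀ i j → β A (column T₂ i) (column T₂ j) ≡ c * c * B i j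
    entries 0F 0F = e₀₀ P u₁ r k h
    entries 0F 1F = e₀₁ P u₁ r k h
    entries 0F 2F = e₀₂ P u₁ r k h
    entries 1F 1F = e₁₁ P u₁ r k h
    entries 1F 2F = e₁₂ P u₁ r k h
    entries 2F 2F = e₂₂ P u₁ r k h
    entries 1F 0F = trans (β-comm A (column T₂ 1F) (column T₂ 0F)) (entries 0F 1F)
    entries 2F 0F = trans (β-comm A (column T₂ 2F) (column T₂ 0F)) (entries 0F 2F)
    entries 2F 1F = trans (β-comm A (column T₂ 2F) (column T₂ 1F)) (entries 1F 2F)

  det-T₁ : det3 T₁ ≡ - (P * P * P)
  det-T₁ = expand P u₁ r k h
    where
    expand : ∀ P u₁ r k h →
        u₁ * (P * 0ℤ - 0ℤ * 0ℤ)
        - P * r * ((P * k - u₁ * r) * 0ℤ - 0ℤ * 1ℤ)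
        + P * P * ((P * k - u₁ * r) * 0ℤ - P * 1ℤ)
      ≡ - (P * P * P)
    expand = solve-∀

  det-T₂ : det3 T₂ ≡ c * c * c
  det-T₂ = expand P u₁ r k h
    where
    expand : ∀ P u₁ r k h →
        ((1ℤ - h) * u₁ - + 2 * (P * h + u₁))
          * ((P * h + + 2 * u₁ + P - + 2 * (k + r) * (P * k - u₁ * r)) * - (+ 2 * (u₁ + P)) - - (+ 2 * (u₁ + P) * (P * k - u₁ * r)) * - (+ 2 * (k + r)))
        - ((P * h + + 2 * u₁ + P) * r - + 2 * (k + r) * (u₁ + P))
          * ((1ℤ - h) * (P * k - u₁ * r) * - (+ 2 * (u₁ + P)) - - (+ 2 * (u₁ + P) * (P * k - u₁ * r)) * (1ℤ - h))
        + ((P * h + + 2 * u₁ + P) * P - + 2 * (u₁ + P) * (u₁ + P))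
          * ((1ℤ - h) * (P * k - u₁ * r) * - (+ 2 * (k + r)) - (P * h + + 2 * u₁ + P - + 2 * (k + r) * (P * k - u₁ * r)) * (1ℤ - h))
      ≡ (P * h + + 2 * u₁ + P) * (P * h + + 2 * u₁ + P) * (P * h + + 2 * u₁ + P)
    expand = solve-∀

  T₁*ξ : ∀ w i → (T₁ *ᵥ ξ w) i ≡ P * P * w i
  T₁*ξ w 0F = e₀ P u₁ r k h (w 0F) (w 1F) (w 2F)
    where
    e₀ : ∀ P u₁ r k h w₀ w₁ w₂ →
        u₁ * (P * P * w₂)
        + (P * r * (P * (w₁ - (P * k - u₁ * r) * w₂)) + (P * P * (w₀ - u₁ * w₂ - r * w₁ + r * (P * k - u₁ * r) * w₂) + 0ℤ))
      ≡ P * P * w₀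
    e₀ = solve-∀
  T₁*ξ w 1F = e₁ P u₁ r k h (w 0F) (w 1F) (w 2F)
    where
    e₁ : ∀ P u₁ r k h w₀ w₁ w₂ →
        (P * k - u₁ * r) * (P * P * w₂)
        + (P * (P * (w₁ - (P * k - u₁ * r) * w₂)) + (0ℤ * (w₀ - u₁ * w₂ - r * w₁ + r * (P * k - u₁ * r) * w₂) + 0ℤ))
      ≡ P * P * w₁
    e₁ = solve-∀
  T₁*ξ w 2F = e₂ P u₁ r k h (w 0F) (w 1F) (w 2F)
    where
    e₂ : ∀ P u₁ r k h w₀ w₁ w₂ →
        1ℤ * (P * P * w₂)
        + (0ℤ * (P * (w₁ - (P * k - u₁ * r) * w₂)) + (0ℤ * (w₀ - u₁ * w₂ - r * w₁ + r * (P * k - u₁ * r) * w₂) + 0ℤ))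
      ≡ P * P * w₂
    e₂ = solve-∀

  P∣u₁*ξ₂-β[u,w] : ∀ w → P ℤ.∣ u₁ * ξ w 2F - β A u w
  P∣u₁*ξ₂-β[u,w] w = divides (- (k * w 1F) + (u₂ * k - P * h) * w 2F)
    (trans (expand P u₁ r k h (w 0F) (w 1F) (w 2F)) (ℤ.*-comm P _))
    where
    expand : ∀ P u₁ r k h w₀ w₁ w₂ →
        u₁ * (w₀ - u₁ * w₂ - r * w₁ + r * (P * k - u₁ * r) * w₂)
        - (u₁ * w₀ + (P * k - u₁ * r) * w₁ + (P * P * h - u₁ * u₁ - (P * k - u₁ * r) * (P * k - u₁ * r)) * (1ℤ * w₂))
      ≡ P * (- (k * w₁) + ((P * k - u₁ * r) * k - P * h) * w₂)
    expand = solve-∀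

-- Representations with coordinates prime to p

Primitive : ℕ → Vec3 → Set
Primitive p v = ¬ (∀ i → + p ℤ.∣ v i)

module ZerosModP {p a} (p-prime : Prime p) (p≡3 : p % 4 ≡ 3)
                 {s} (p∣s²-a : + p ℤ.∣ s * s - + a) (p∤a : ¬ + p ℤ.∣ + a) where

  p∤s : ¬ + p ℤ.∣ s
  p∤s p∣s = p∤a (subst (+ p ℤ.∣_) (cancel s (+ a)) (ℤ.∣m∣n⇒∣m-n (ℤ.∣m⇒∣m*n s p∣s) p∣s²-a))
    where
    cancel : ∀ s a → s * s - (s * s - a) ≡ a
    cancel = solve-∀

  ∣Q⇒∣x²+y²+[sz]² : ∀ v → + p ℤ.∣ Q (+ a) v → + p ℤ.∣ v 0F * v 0F + v 1F * v 1F + s * v 2F * (s * v 2F)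
  ∣Q⇒∣x²+y²+[sz]² v p∣Q = subst (+ p ℤ.∣_) (shift (v 0F) (v 1F) (v 2F) s (+ a))
    (ℤ.∣m∣n⇒∣m+n p∣Q (ℤ.∣m⇒∣m*n (v 2F * v 2F) p∣s²-a))
    where
    shift : ∀ x y z s a → x * x + y * y + a * (z * z) + (s * s - a) * (z * z) ≡ x * x + y * y + s * z * (s * z)
    shift = solve-∀

  ∣Q⇒∣vᵢ⇒∣v : ∀ v → + p ℤ.∣ Q (+ a) v → ∀ i → + p ℤ.∣ v i → ∀ j → + p ℤ.∣ v j
  ∣Q⇒∣vᵢ⇒∣v v p∣Q i p∣vᵢ = all i p∣vᵢ
    where
    x y t : ℤ
    x = v 0F
    y = v 1F
    t = s * v 2F
    p∣x²+y²+t² : + p ℤ.∣ x * x + y * y + t * t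
    p∣x²+y²+t² = ∣Q⇒∣x²+y²+[sz]² v p∣Q

    ∣first⇒∣rest : ∀ x y t → + p ℤ.∣ x * x + y * y + t * t → + p ℤ.∣ x → + p ℤ.∣ y × + p ℤ.∣ t
    ∣first⇒∣rest x y t p∣sum p∣x =
      ∣x*x+y*y⇒∣x p-prime p≡3 y t p∣y²+t² , ∣x*x+y*y⇒∣y p-prime p≡3 y t p∣y²+t²
      where
      drop : ∀ x y t → x * x + y * y + t * t - x * x ≡ y * y + t * t
      drop = solve-∀
      p∣y²+t² : + p ℤ.∣ y * y + t * t
      p∣y²+t² = subst (+ p ℤ.∣_) (drop x y t) (ℤ.∣m∣n⇒∣m-n p∣sum (ℤ.∣m⇒∣m*n x p∣x))

    ∣t⇒∣z : + p ℤ.∣ t → + p ℤ.∣ v 2F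
    ∣t⇒∣z p∣t = Sum.[ (λ p∣s → contradiction p∣s p∤s) , id ] (euclidsLemmaℤ s (v 2F) p-prime p∣t)

    rotate₁ : ∀ x y t → x * x + y * y + t * t ≡ y * y + x * x + t * t
    rotate₁ = solve-∀
    rotate₂ : ∀ x y t → x * x + y * y + t * t ≡ t * t + x * x + y * y
    rotate₂ = solve-∀

    p∣y²+x²+t² : + p ℤ.∣ y * y + x * x + t * t
    p∣y²+x²+t² = subst (+ p ℤ.∣_) (rotate₁ x y t) p∣x²+y²+t²
    p∣t²+x²+y² : + p ℤ.∣ t * t + x * x + y * y
    p∣t²+x²+y² = subst (+ p ℤ.∣_) (rotate₂ x y t) p∣x²+y²+t²

    all : ∀ i → + p ℤ.∣ v i → ∀ j → + p ℤ.∣ v j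
    all 0F p∣x 0F = p∣x
    all 0F p∣x 1F = proj₁ (∣first⇒∣rest x y t p∣x²+y²+t² p∣x)
    all 0F p∣x 2F = ∣t⇒∣z (proj₂ (∣first⇒∣rest x y t p∣x²+y²+t² p∣x))
    all 1F p∣y 0F = proj₁ (∣first⇒∣rest y x t p∣y²+x²+t² p∣y)
    all 1F p∣y 1F = p∣y
    all 1F p∣y 2F = ∣t⇒∣z (proj₂ (∣first⇒∣rest y x t p∣y²+x²+t² p∣y))
    all 2F p∣z 0F = proj₁ (∣first⇒∣rest t x y p∣t²+x²+y² (ℤ.∣n⇒∣m*n s p∣z))
    all 2F p∣z 1F = proj₂ (∣first⇒∣rest t x y p∣t²+x²+y² (ℤ.∣n⇒∣m*n s p∣z))
    all 2F p∣z 2F = p∣z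

  primitive⇒units : ∀ v → + p ℤ.∣ Q (+ a) v → Primitive p v → ∀ i → ¬ + p ℤ.∣ v i
  primitive⇒units v p∣Q prim i p∣vᵢ = prim (∣Q⇒∣vᵢ⇒∣v v p∣Q i p∣vᵢ)

-- Parameters of Lattice whose A is the given a: u is then isotropic modulo p² for x² + y² + a z².
record Isotropic (p a : ℕ) : Set where
  field
    u₁ r k h : ℤ
    a≡A : + a ≡ Lattice.A (+ p) u₁ r k h
    p∤u₁ : ¬ + p ℤ.∣ u₁
    p∤u₂ : ¬ + p ℤ.∣ Lattice.u₂ (+ p) u₁ r k h

isotropic : ∀ {p a s} → Prime p → p % 4 ≡ 3 → + p ℤ.∣ s * s - + a → ¬ + p ℤ.∣ + a → Isotropic p a
isotropic {p} {a} {s} p-prime p≡3 p∣s²-a p∤a = record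
  { u₁ = u₁ ; r = r ; k = k ; h = h ; a≡A = a≡A
  ; p∤u₁ = p∤u₁ ; p∤u₂ = subst (λ z → ¬ P ℤ.∣ z) (sym u₂≡y) p∤y }
  where
  open ZerosModP p-prime p≡3 {s} p∣s²-a p∤a
  P : ℤ
  P = + p
  solution : ∃₂ λ x y → P ℤ.∣ x * x + y * y + + a
  solution = x*x+y*y+c-solvable {m = proj₁ (p≡1+2m {p} p≡3)} p-prime (proj₂ (p≡1+2m {p} p≡3)) (+ a)
  x y : ℤ
  x = proj₁ solution
  y = proj₁ (proj₂ solution)
  p∣x²+y²+a : P ℤ.∣ x * x + y * y + + a
  p∣x²+y²+a = proj₂ (proj₂ solution)
  v : Vec3
  v = x ∷ y ∷ 1ℤ ∷ []
  p∣Qv : P ℤ.∣ Q (+ a) v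
  p∣Qv = subst (P ℤ.∣_) (cong (λ z → x * x + y * y + z) (sym (ℤ.*-identityʳ (+ a)))) p∣x²+y²+a
  p∤x : ¬ P ℤ.∣ x
  p∤x = primitive⇒units v p∣Qv (λ p∣v → prime∤1 p-prime (p∣v 2F)) 0F
  p∤y : ¬ P ℤ.∣ y
  p∤y = primitive⇒units v p∣Qv (λ p∣v → prime∤1 p-prime (p∣v 2F)) 1F
  lifted : ∃ λ x′ → P ℤ.∣ x′ - x × P * P ℤ.∣ x′ * x′ + (y * y + + a)
  lifted = hensel p-prime x (y * y + + a) (subst (P ℤ.∣_) (ℤ.+-assoc (x * x) (y * y) (+ a)) p∣x²+y²+a)
                  (∤*∤⇒∤* p-prime (∤2 p≡3) p∤x)
  u₁ : ℤ
  u₁ = proj₁ lifted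
  p∤u₁ : ¬ P ℤ.∣ u₁
  p∤u₁ p∣u₁ = p∤x (subst (P ℤ.∣_) (cancel u₁ x) (ℤ.∣m∣n⇒∣m-n p∣u₁ (proj₁ (proj₂ lifted))))
    where
    cancel : ∀ u x → u - (u - x) ≡ x
    cancel = solve-∀
  h : ℤ
  h = ℤ._∣_.quotient (proj₂ (proj₂ lifted))
  norm : u₁ * u₁ + (y * y + + a) ≡ h * (P * P)
  norm = ℤ._∣_.equality (proj₂ (proj₂ lifted))
  ι e r k : ℤ
  ι = proj₁ (mod-inverse p-prime u₁ p∤u₁)
  e = ℤ._∣_.quotient (proj₂ (mod-inverse p-prime u₁ p∤u₁))
  r = - (y * ι)
  k = - (y * e)
  u₁ι-1≡eP : u₁ * ι - 1ℤ ≡ e * P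
  u₁ι-1≡eP = ℤ._∣_.equality (proj₂ (mod-inverse p-prime u₁ p∤u₁))
  u₂≡y : P * k - u₁ * r ≡ y
  u₂≡y = begin
    P * - (y * e) - u₁ * - (y * ι)  ≡⟨ expand P y e u₁ ι ⟩
    y + y * (u₁ * ι - 1ℤ) - y * (e * P) ≡⟨ cong (λ z → y + y * z - y * (e * P)) u₁ι-1≡eP ⟩
    y + y * (e * P) - y * (e * P) ≡⟨ cancel y (y * (e * P)) ⟩
    y ∎
    where
    open ≡-Reasoning
    expand : ∀ P y e u ι → P * - (y * e) - u * - (y * ι) ≡ y + y * (u * ι - 1ℤ) - y * (e * P)
    expand = solve-∀
    cancel : ∀ y z → y + z - z ≡ y
    cancel = solve-∀
  a≡A : + a ≡ Lattice.A P u₁ r k h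
  a≡A = begin
    + a                                           ≡⟨ isolate u₁ y (+ a) ⟩
    u₁ * u₁ + (y * y + + a) - u₁ * u₁ - y * y    ≡⟨ cong (λ z → z - u₁ * u₁ - y * y) norm ⟩
    h * (P * P) - u₁ * u₁ - y * y
      ≡⟨ cong₂ (λ z w → z - u₁ * u₁ - w * w) (ℤ.*-comm h (P * P)) (sym u₂≡y) ⟩
    P * P * h - u₁ * u₁ - (P * k - u₁ * r) * (P * k - u₁ * r) ∎
    where
    open ≡-Reasoning
    isolate : ∀ u y a → a ≡ u * u + (y * y + a) - u * u - y * y
    isolate = solve-∀

flip₀ flip₁ : Vec3 → Vec3
flip₀ w = - w 0F ∷ w 1F ∷ w 2F ∷ []
flip₁ w = w 0F ∷ - w 1F ∷ w 2F ∷ []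

Q-flip₀ : ∀ A w → Q A (flip₀ w) ≡ Q A w
Q-flip₀ A w = neg² A (w 0F) (w 1F) (w 2F)
  where
  neg² : ∀ A x y z → - x * - x + y * y + A * (z * z) ≡ x * x + y * y + A * (z * z)
  neg² = solve-∀

Q-flip₁ : ∀ A w → Q A (flip₁ w) ≡ Q A w
Q-flip₁ A w = neg² A (w 0F) (w 1F) (w 2F)
  where
  neg² : ∀ A x y z → x * x + - y * - y + A * (z * z) ≡ x * x + y * y + A * (z * z)
  neg² = solve-∀

sign-flip : ∀ {p} → Prime p → ¬ + p ℤ.∣ + 2 →
            ∀ {A u₁ u₂} → ¬ + p ℤ.∣ A → ¬ + p ℤ.∣ u₁ → ¬ + p ℤ.∣ u₂ → ∀ w → Primitive p w →
            ∃ λ w′ → (∀ A′ → Q A′ w′ ≡ Q A′ w) × ¬ + p ℤ.∣ β A (u₁ ∷ u₂ ∷ 1ℤ ∷ []) w′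
sign-flip {p} p-prime p∤2 {A} {u₁} {u₂} p∤A p∤u₁ p∤u₂ w prim
  with + p ℤ.∣? b w | + p ℤ.∣? b (flip₀ w) | + p ℤ.∣? b (flip₁ w) | + p ℤ.∣? b (flip₀ (flip₁ w))
  where
  b : Vec3 → ℤ
  b = β A (u₁ ∷ u₂ ∷ 1ℤ ∷ [])
... | no p∤b | _ | _ | _ = w , (λ _ → refl) , p∤b
... | yes _ | no p∤b | _ | _ = flip₀ w , (λ A′ → Q-flip₀ A′ w) , p∤b
... | yes _ | yes _ | no p∤b | _ = flip₁ w , (λ A′ → Q-flip₁ A′ w) , p∤b
... | yes _ | yes _ | yes _ | no p∤b =
  flip₀ (flip₁ w) , (λ A′ → trans (Q-flip₀ A′ (flip₁ w)) (Q-flip₁ A′ w)) , p∤b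
... | yes p∣b | yes p∣b₀ | yes p∣b₁ | yes p∣b₀₁ = contradiction all prim
  where
  ∣2xy⇒∣y : ∀ {x y} → ¬ + p ℤ.∣ x → + p ℤ.∣ + 2 * (x * y) → + p ℤ.∣ y
  ∣2xy⇒∣y {x} {y} p∤x p∣2xy = Sum.[ (λ p∣2 → contradiction p∣2 p∤2) ,
    (λ p∣xy → Sum.[ (λ p∣x → contradiction p∣x p∤x) , id ] (euclidsLemmaℤ x y p-prime p∣xy)) ]
    (euclidsLemmaℤ (+ 2) (x * y) p-prime p∣2xy)
  diff₀ : ∀ u₁ u₂ A x y z →
          u₁ * x + u₂ * y + A * (1ℤ * z) - (u₁ * - x + u₂ * y + A * (1ℤ * z)) ≡ + 2 * (u₁ * x)
  diff₀ = solve-∀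
  diff₁ : ∀ u₁ u₂ A x y z →
          u₁ * x + u₂ * y + A * (1ℤ * z) - (u₁ * x + u₂ * - y + A * (1ℤ * z)) ≡ + 2 * (u₂ * y)
  diff₁ = solve-∀
  sum₀₁ : ∀ u₁ u₂ A x y z →
          u₁ * x + u₂ * y + A * (1ℤ * z) + (u₁ * - x + u₂ * - y + A * (1ℤ * z)) ≡ + 2 * (A * z)
  sum₀₁ = solve-∀
  all : ∀ i → + p ℤ.∣ w i
  all 0F = ∣2xy⇒∣y p∤u₁ (subst (+ p ℤ.∣_) (diff₀ u₁ u₂ A _ _ _) (ℤ.∣m∣n⇒∣m-n p∣b p∣b₀))
  all 1F = ∣2xy⇒∣y p∤u₂ (subst (+ p ℤ.∣_) (diff₁ u₁ u₂ A _ _ _) (ℤ.∣m∣n⇒∣m-n p∣b p∣b₁))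
  all 2F = ∣2xy⇒∣y p∤A (subst (+ p ℤ.∣_) (sum₀₁ u₁ u₂ A _ _ _) (ℤ.∣m∣n⇒∣m+n p∣b p∣b₀₁))

module Lift {p a} (p-prime : Prime p) (p≡3 : p % 4 ≡ 3) (0<a : 0 < a) (p∤a : ¬ + p ℤ.∣ + a)
            (iso : Isotropic p a) (class-number-one : ClassNumberOne (diag11a a)) where
  open Isotropic iso
  open Lattice (+ p) u₁ r k h

  P : ℤ
  P = + p

  P≢0 : P ≢ 0ℤ
  P≢0 P≡0 = ℕ.≢-nonZero⁻¹ p {{prime⇒nonZero p-prime}} (ℤ.+-injective P≡0)

  P*P≢0 : P * P ≢ 0ℤ
  P*P≢0 P*P≡0 = Sum.[ P≢0 , P≢0 ] (ℤ.i*j≡0⇒i≡0∨j≡0 P P*P≡0)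

  gram : ∀ {T d} → (∀ i j → β A (column T i) (column T j) ≡ d * d * B i j) →
         ∀ i j → congruent T (diag11a a) i j ≡ d * d * B i j
  gram {T} g i j =
    trans (congruent-diag11a a T i j) (trans (cong (λ A′ → β A′ (column T i) (column T j)) a≡A) (g i j))

  Q∘T₁ : ∀ x → Q (+ a) (T₁ *ᵥ x) ≡ P * P * evalQF B x
  Q∘T₁ x = begin
    Q (+ a) (T₁ *ᵥ x)                  ≡⟨ sym (evalQF-diag11a a (T₁ *ᵥ x)) ⟩
    evalQF (diag11a a) (T₁ *ᵥ x)       ≡⟨ sym (evalQF-congruent (diag11a a) T₁ x) ⟩
    evalQF (congruent T₁ (diag11a a)) x ≡⟨ evalQF-cong x (gram {T₁} {P} gram-T₁) ⟩
    evalQF (λ i j → P * P * B i j) x    ≡⟨ evalQF-scale (P * P) B x ⟩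
    P * P * evalQF B x                 ∎
    where open ≡-Reasoning

  B-symmetric : Symmetric B
  B-symmetric 0F 0F = refl
  B-symmetric 0F 1F = refl
  B-symmetric 0F 2F = refl
  B-symmetric 1F 0F = refl
  B-symmetric 1F 1F = refl
  B-symmetric 1F 2F = refl
  B-symmetric 2F 0F = refl
  B-symmetric 2F 1F = refl
  B-symmetric 2F 2F = refl

  T₁x≡0⇒x≡0 : ∀ x → (∀ i → (T₁ *ᵥ x) i ≡ 0ℤ) → ∀ i → x i ≡ 0ℤ
  T₁x≡0⇒x≡0 x T₁x≡0 = x≡0
    where
    row₂ : ∀ x₀ x₁ x₂ → 1ℤ * x₀ + (0ℤ * x₁ + (0ℤ * x₂ + 0ℤ)) ≡ x₀
    row₂ = solve-∀
    row₁ : ∀ u P x₁ x₂ → u * 0ℤ + (P * x₁ + (0ℤ * x₂ + 0ℤ)) ≡ P * x₁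
    row₁ = solve-∀
    row₀ : ∀ u P r x₂ → u * 0ℤ + (P * r * 0ℤ + (P * P * x₂ + 0ℤ)) ≡ P * P * x₂
    row₀ = solve-∀
    x₀≡0 : x 0F ≡ 0ℤ
    x₀≡0 = trans (sym (row₂ (x 0F) (x 1F) (x 2F))) (T₁x≡0 2F)
    x₁≡0 : x 1F ≡ 0ℤ
    x₁≡0 = Sum.[ (λ P≡0 → contradiction P≡0 P≢0) , id ] (ℤ.i*j≡0⇒i≡0∨j≡0 P
      (trans (sym (row₁ u₂ P (x 1F) (x 2F)))
             (subst (λ z → u₂ * z + (P * x 1F + (0ℤ * x 2F + 0ℤ)) ≡ 0ℤ) x₀≡0 (T₁x≡0 1F))))
    x₂≡0 : x 2F ≡ 0ℤ
    x₂≡0 = Sum.[ (λ P²≡0 → contradiction P²≡0 P*P≢0) , id ] (ℤ.i*j≡0⇒i≡0∨j≡0 (P * P)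
      (trans (sym (row₀ u₁ P r (x 2F)))
             (subst₂ (λ z w → u₁ * z + (P * r * w + (P * P * x 2F + 0ℤ)) ≡ 0ℤ) x₀≡0 x₁≡0 (T₁x≡0 0F))))
    x≡0 : ∀ i → x i ≡ 0ℤ
    x≡0 0F = x₀≡0
    x≡0 1F = x₁≡0
    x≡0 2F = x₂≡0

  T₁-nonzero : ∀ x → (Σ (Fin 3) λ i → x i ≢ 0ℤ) → Σ (Fin 3) λ i → (T₁ *ᵥ x) i ≢ 0ℤ
  T₁-nonzero x (i , xᵢ≢0) =
    Fin.¬∀⟶∃¬ 3 _ (λ j → (T₁ *ᵥ x) j ℤ.≟ 0ℤ) (λ T₁x≡0 → xᵢ≢0 (T₁x≡0⇒x≡0 x T₁x≡0 i))

  B-positive-definite : PositiveDefinite B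
  B-positive-definite x x≢0 = ℤ.*-cancelˡ-<-nonNeg (P * P) {{subst ℤ.NonNegative (ℤ.pos-* p p) ℤ.nonNeg}}
    (subst₂ ℤ._<_ (sym (ℤ.*-zeroʳ (P * P))) (Q∘T₁ x) (0<Q (T₁ *ᵥ x) 0<a (T₁-nonzero x x≢0)))

  p∤c : ¬ P ℤ.∣ c
  p∤c p∣c = ∤*∤⇒∤* p-prime (∤2 p≡3) p∤u₁ (subst (P ℤ.∣_) (isolate P h u₁)
    (ℤ.∣m∣n⇒∣m-n (ℤ.∣m∣n⇒∣m-n p∣c (ℤ.∣m⇒∣m*n h ℤ.∣-refl)) ℤ.∣-refl))
    where
    isolate : ∀ P h u → P * h + + 2 * u + P - P * h - P ≡ + 2 * u
    isolate = solve-∀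

  B-genus : SameGenus (diag11a a) B
  B-genus q q-prime with q ℕ.≟ p
  ... | yes refl = isometricℤAt-scaled p-prime (diag11a a) B T₂ c (gram {T₂} {c} gram-T₂) p∤c p∤det-T₂
    where
    p∤det-T₂ : ¬ P ℤ.∣ det3 T₂
    p∤det-T₂ = subst (λ z → ¬ P ℤ.∣ z) (sym det-T₂) (∤*∤⇒∤* p-prime (∤*∤⇒∤* p-prime p∤c p∤c) p∤c)
  ... | no q≢p = isometricℤAt-scaled q-prime (diag11a a) B T₁ P (gram {T₁} {P} gram-T₁) q∤P q∤det-T₁
    where
    q∤P : ¬ + q ℤ.∣ P
    q∤P = ∤-distinct-prime p-prime q-prime q≢p
    q∤det-T₁ : ¬ + q ℤ.∣ det3 T₁
    q∤det-T₁ q∣det = ∤*∤⇒∤* q-prime (∤*∤⇒∤* q-prime q∤P q∤P) q∤P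
      (subst (+ q ℤ.∣_) (trans (cong -_ det-T₁) (ℤ.neg-involutive _)) (ℤ.∣m⇒∣-m q∣det))

  isometry : Isometricℤ (diag11a a) B
  isometry = class-number-one B B-symmetric B-positive-definite B-genus

  B∘ξ : ∀ w → evalQF B (ξ w) ≡ P * P * Q (+ a) w
  B∘ξ w = ℤ.*-cancelˡ-≡ (P * P) _ _ {{ℤ.≢-nonZero P*P≢0}} (begin
    P * P * evalQF B (ξ w)          ≡⟨ sym (Q∘T₁ (ξ w)) ⟩
    Q (+ a) (T₁ *ᵥ ξ w)             ≡⟨ Q-cong (+ a) (T₁*ξ w) ⟩
    Q (+ a) (λ i → P * P * w i)     ≡⟨ Q-scale (+ a) (P * P) w ⟩
    P * P * (P * P) * Q (+ a) w     ≡⟨ ℤ.*-assoc (P * P) (P * P) (Q (+ a) w) ⟩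
    P * P * (P * P * Q (+ a) w)     ∎)
    where open ≡-Reasoning

  lift : ∀ w → Primitive p w → ∃ λ v → Q (+ a) v ≡ P * P * Q (+ a) w × Primitive p v
  lift w prim = M *ᵥ ξ w′ , Q[Mξ] , primitive-Mξ
    where
    M : Mat3
    M = proj₁ isometry
    ∣detM∣≡1 : ∣ det3 M ∣ ≡ 1
    ∣detM∣≡1 = proj₁ (proj₂ isometry)
    MᵀDM≡B : ∀ i j → congruent M (diag11a a) i j ≡ B i j
    MᵀDM≡B = proj₂ (proj₂ isometry)
    p∤A : ¬ P ℤ.∣ A
    p∤A = subst (λ z → ¬ P ℤ.∣ z) a≡A p∤a
    flipped : ∃ λ w′ → (∀ A′ → Q A′ w′ ≡ Q A′ w) × ¬ P ℤ.∣ β A u w′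
    flipped = sign-flip p-prime (∤2 p≡3) p∤A p∤u₁ p∤u₂ w prim
    w′ : Vec3
    w′ = proj₁ flipped

    Q[Mξ] : Q (+ a) (M *ᵥ ξ w′) ≡ P * P * Q (+ a) w
    Q[Mξ] = begin
      Q (+ a) (M *ᵥ ξ w′)                      ≡⟨ sym (evalQF-diag11a a (M *ᵥ ξ w′)) ⟩
      evalQF (diag11a a) (M *ᵥ ξ w′)           ≡⟨ sym (evalQF-congruent (diag11a a) M (ξ w′)) ⟩
      evalQF (congruent M (diag11a a)) (ξ w′)  ≡⟨ evalQF-cong (ξ w′) MᵀDM≡B ⟩
      evalQF B (ξ w′)                          ≡⟨ B∘ξ w′ ⟩
      P * P * Q (+ a) w′                       ≡⟨ cong (P * P *_) (proj₁ (proj₂ flipped) (+ a)) ⟩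
      P * P * Q (+ a) w                        ∎
      where open ≡-Reasoning

    primitive-Mξ : Primitive p (M *ᵥ ξ w′)
    primitive-Mξ p∣Mξ = proj₂ (proj₂ flipped) (subst (P ℤ.∣_) (cancel (u₁ * ξ w′ 2F) (β A u w′))
      (ℤ.∣m∣n⇒∣m-n (ℤ.∣n⇒∣m*n u₁ p∣ξ₂) (P∣u₁*ξ₂-β[u,w] w′)))
      where
      p∣ξ₂ : P ℤ.∣ ξ w′ 2F
      p∣ξ₂ = ∣det*x⇒∣x {det = det3 M} ∣detM∣≡1 (∣*ᵥ⇒∣det3*x₂ M (ξ w′) p∣Mξ)
      cancel : ∀ x y → x - (x - y) ≡ y
      cancel = solve-∀

primitive-representation : ∀ {p a} → Prime p →
  (∀ w → Primitive p w → ∃ λ v → Q (+ a) v ≡ + p * + p * Q (+ a) w × Primitive p v) →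
  ∀ N → 0 < N → (∃ λ x → + N ≡ Q (+ a) x) → ∃ λ x → + N ≡ Q (+ a) x × Primitive p x
primitive-representation {p} {a} p-prime lift = <-rec Goal step
  where
  P : ℤ
  P = + p
  Goal : ℕ → Set
  Goal N = 0 < N → (∃ λ x → + N ≡ Q (+ a) x) → ∃ λ x → + N ≡ Q (+ a) x × Primitive p x

  step : ∀ N → (∀ {M} → M < N → Goal M) → Goal N
  step N rec 0<N (x , N≡Qx) with Fin.all? (λ i → P ℤ.∣? x i)
  ... | no p∤x = x , N≡Qx , p∤x
  ... | yes p∣x =
    proj₁ lifted , trans N≡P²N′ (trans (cong (P * P *_) N′≡Qy) (sym (proj₁ (proj₂ lifted)))) , proj₂ (proj₂ lifted)
    where
    x′ : Vec3
    x′ i = ℤ._∣_.quotient (p∣x i)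
    N′ : ℕ
    N′ = Qℕ a x′
    N≡P²N′ : + N ≡ P * P * + N′
    N≡P²N′ = begin
      + N                        ≡⟨ N≡Qx ⟩
      Q (+ a) x                  ≡⟨ Q-cong (+ a) (λ i → trans (ℤ._∣_.equality (p∣x i)) (ℤ.*-comm (x′ i) P)) ⟩
      Q (+ a) (λ i → P * x′ i)   ≡⟨ Q-scale (+ a) P x′ ⟩
      P * P * Q (+ a) x′         ≡⟨ cong (P * P *_) (Q≡+Qℕ a x′) ⟩
      P * P * + N′               ∎
      where open ≡-Reasoning
    N≡N′*p*p : N ≡ N′ ℕ.* (p ℕ.* p)
    N≡N′*p*p = ℤ.+-injective (begin
      + N                  ≡⟨ N≡P²N′ ⟩
      P * P * + N′         ≡⟨ cong (ℤ._* + N′) (sym (ℤ.pos-* p p)) ⟩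
      + (p ℕ.* p) * + N′   ≡⟨ sym (ℤ.pos-* (p ℕ.* p) N′) ⟩
      + (p ℕ.* p ℕ.* N′)   ≡⟨ cong +_ (ℕ.*-comm (p ℕ.* p) N′) ⟩
      + (N′ ℕ.* (p ℕ.* p)) ∎)
      where open ≡-Reasoning
    0<N′ : 0 < N′
    0<N′ = ℕ.n≢0⇒n>0 λ N′≡0 → ℕ.<⇒≢ 0<N (sym (trans N≡N′*p*p (cong (ℕ._* (p ℕ.* p)) N′≡0)))
    N′<N : N′ < N
    N′<N = subst (N′ <_) (sym N≡N′*p*p) (ℕ.m<m*n N′ (p ℕ.* p) {{ℕ.>-nonZero 0<N′}} 1<p*p)
      where
      1<p*p : 1 < p ℕ.* p
      1<p*p = ℕ.<-≤-trans (ℕ.nonTrivial⇒n>1 p {{prime⇒nonTrivial p-prime}})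
                          (ℕ.m≤m*n p p {{prime⇒nonZero p-prime}})
    descended : ∃ λ y → + N′ ≡ Q (+ a) y × Primitive p y
    descended = rec N′<N 0<N′ (x′ , sym (Q≡+Qℕ a x′))
    y : Vec3
    y = proj₁ descended
    N′≡Qy : + N′ ≡ Q (+ a) y
    N′≡Qy = proj₁ (proj₂ descended)
    lifted : ∃ λ v → Q (+ a) v ≡ P * P * Q (+ a) y × Primitive p v
    lifted = lift y (proj₂ (proj₂ descended))

-- Sums of squares not divisible by p

∤⇒coprime : ∀ {p} → Prime p → ∀ t → ¬ + p ℤ.∣ t → Coprime p ∣ t ∣
∤⇒coprime p-prime t p∤t (d∣p , d∣t) with prime⇒irreducible p-prime d∣p
... | inj₁ d≡1 = d≡1
... | inj₂ refl = contradiction (ℤ.∣ᵤ⇒∣ d∣t) p∤t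

coprime⇒∤ : ∀ {p} → Prime p → ∀ t → Coprime p ∣ t ∣ → ¬ + p ℤ.∣ t
coprime⇒∤ p-prime t coprime p∣t with coprime (ℕ.∣-refl , ℤ.∣⇒∣ᵤ p∣t)
... | refl = ¬prime[1] p-prime

∤prodℤ : ∀ {p k} → Prime p → (v : Fin k → ℤ) → (∀ i → ¬ + p ℤ.∣ v i) → ¬ + p ℤ.∣ prodℤ v
∤prodℤ {k = ℕ.zero} p-prime v p∤v = prime∤1 p-prime
∤prodℤ {k = ℕ.suc k} p-prime v p∤v = ∤*∤⇒∤* p-prime (p∤v zero) (∤prodℤ p-prime (v ∘ suc) (p∤v ∘ suc))

∣vᵢ⇒∣prodℤ : ∀ {d k} (v : Fin k → ℤ) i → d ℤ.∣ v i → d ℤ.∣ prodℤ v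
∣vᵢ⇒∣prodℤ v zero d∣v₀ = ℤ.∣m⇒∣m*n _ d∣v₀
∣vᵢ⇒∣prodℤ v (suc i) d∣vᵢ = ℤ.∣n⇒∣m*n (v zero) (∣vᵢ⇒∣prodℤ (v ∘ suc) i d∣vᵢ)

UnitRepresentation : ℕ → ℕ → ℕ → Set
UnitRepresentation p a n = ∃ λ v → + n ≡ Q (+ a) v × ∀ i → ¬ + p ℤ.∣ v i

sum-of-3-squares : ∀ {p a n} → Prime p → ¬ + p ℤ.∣ + a → IsSquare a →
                   UnitRepresentation p a n → SumOfSquaresNotDiv 3 p n
sum-of-3-squares {p} {a} p-prime p∤a (m , a≡m*m) (v , n≡Qv , units) =
  x , trans n≡Qv (trans (cong (λ A → Q A v) a≡m*m′) (regroup (v 0F) (v 1F) (v 2F) (+ m))) ,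
  ∤⇒coprime p-prime (prodℤ x) (∤prodℤ p-prime x x-units)
  where
  x : Fin 3 → ℤ
  x = v 0F ∷ v 1F ∷ + m * v 2F ∷ []
  regroup : ∀ x y z m → x * x + y * y + m * m * (z * z) ≡ x * x + (y * y + (m * z * (m * z) + 0ℤ))
  regroup = solve-∀
  a≡m*m′ : + a ≡ + m * + m
  a≡m*m′ = trans (cong +_ a≡m*m) (ℤ.pos-* m m)
  p∤m : ¬ + p ℤ.∣ + m
  p∤m p∣m = p∤a (subst (+ p ℤ.∣_) (sym a≡m*m′) (ℤ.∣m⇒∣m*n (+ m) p∣m))
  x-units : ∀ i → ¬ + p ℤ.∣ x i
  x-units 0F = units 0F
  x-units 1F = units 1F
  x-units 2F = ∤*∤⇒∤* p-prime p∤m (units 2F)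

sum-of-4-squares : ∀ {p a n} → Prime p → SumOfSquaresNotDiv 2 p a →
                   UnitRepresentation p a n → SumOfSquaresNotDiv 4 p n
sum-of-4-squares {p} {a} p-prime (w , a≡w₀²+w₁² , coprime) (v , n≡Qv , units) =
  x , trans n≡Qv (trans (cong (λ A → Q A v) a≡w₀²+w₁²) (regroup (v 0F) (v 1F) (v 2F) (w 0F) (w 1F))) ,
  ∤⇒coprime p-prime (prodℤ x) (∤prodℤ p-prime x x-units)
  where
  x : Fin 4 → ℤ
  x = v 0F ∷ v 1F ∷ w 0F * v 2F ∷ w 1F * v 2F ∷ []
  regroup : ∀ x y z w₀ w₁ → x * x + y * y + (w₀ * w₀ + (w₁ * w₁ + 0ℤ)) * (z * z)
                          ≡ x * x + (y * y + (w₀ * z * (w₀ * z) + (w₁ * z * (w₁ * z) + 0ℤ)))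
  regroup = solve-∀
  p∤w : ∀ i → ¬ + p ℤ.∣ w i
  p∤w i p∣wᵢ = coprime⇒∤ p-prime (prodℤ w) coprime (∣vᵢ⇒∣prodℤ w i p∣wᵢ)
  x-units : ∀ i → ¬ + p ℤ.∣ x i
  x-units 0F = units 0F
  x-units 1F = units 1F
  x-units 2F = ∤*∤⇒∤* p-prime (p∤w 0F) (units 2F)
  x-units 3F = ∤*∤⇒∤* p-prime (p∤w 1F) (units 2F)

lemma3p6 : (p n a : ℕ) → Prime p → p % 4 ≡ 3 → 0 < n → 0 < a
    → ClassNumberOne (diag11a a)
    → (IsSquare a ⊎ SumOfSquaresNotDiv 2 p a)
    → LegendreIsOne a p → p ∣ n
    → RepresentedBy11a a n
    → (IsSquare a → SumOfSquaresNotDiv 3 p n) × (SumOfSquaresNotDiv 2 p a → SumOfSquaresNotDiv 4 p n)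
lemma3p6 p n a p-prime p≡3 0<n 0<a class-number-one _ (p∤a , s , p∣s²-a) p∣n (x , y , z , n≡Q) =
  (λ a-square → sum-of-3-squares p-prime p∤aℤ a-square unit-representation) ,
  (λ a-two-squares → sum-of-4-squares p-prime a-two-squares unit-representation)
  where
  p∤aℤ : ¬ + p ℤ.∣ + a
  p∤aℤ = p∤a ∘ ℤ.∣⇒∣ᵤ
  p∣s²-aℤ : + p ℤ.∣ s * s - + a
  p∣s²-aℤ = ℤ.∣ᵤ⇒∣ p∣s²-a
  open ZerosModP p-prime p≡3 {s} p∣s²-aℤ p∤aℤ using (primitive⇒units)
  open Lift p-prime p≡3 0<a p∤aℤ (isotropic {s = s} p-prime p≡3 p∣s²-aℤ p∤aℤ) class-number-one using (lift)
  primitive-rep : ∃ λ v → + n ≡ Q (+ a) v × Primitive p v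
  primitive-rep = primitive-representation {a = a} p-prime lift n 0<n ((x ∷ y ∷ z ∷ []) , n≡Q)
  v : Vec3
  v = proj₁ primitive-rep
  n≡Qv : + n ≡ Q (+ a) v
  n≡Qv = proj₁ (proj₂ primitive-rep)
  unit-representation : UnitRepresentation p a n
  unit-representation =
    v , n≡Qv , primitive⇒units v (subst (+ p ℤ.∣_) n≡Qv (ℤ.∣ᵤ⇒∣ p∣n)) (proj₂ (proj₂ primitive-rep))
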